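{- Let $n$ elements with distinct values arrive in uniformly random order, $a_t$ the element arriving at time $t$ and $\mathrm{rk}(a_t)\in[n]$ its true rank. Fix a permutation $\sigma$ of $[t]$ and let $\mathcal{O}_\sigma$ be the event $a_{\sigma(1)}<a_{\sigma(2)}<\cdots<a_{\sigma(t)}$. If $\sigma(k)=t$, $k=\Theta_1(t)$ and $t=\Theta_1(n)$, then for any $r$, $\Pr(\mathrm{rk}(a_t)=r\mid \mathcal{O}_\sigma)=O(1/\sqrt{n})$.
   Context: Notation: $v=\Theta_1(n)$ means $v=cn$ for some constant $c$ with $0<c<1$ (similarly $k=\Theta_1(t)$ means $k=c't$ for a constant $0<c'<1$); the constant hidden in $O(\cdot)$ may depend on these constants but not on $n$ or $r$. -}

module Defs where

open import Data.Nat using (ℕ; zero; suc)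
open import Data.Fin using (Fin; toℕ; inject≤; _<_)
open import Data.Fin.Properties using (all?; _≟_; _<?_)
open import Data.List using (List; []; _∷_; [_]; concatMap; map; filter; length; allFin)
open import Data.Vec.Functional using () renaming (_∷_ to _∷ᶠ_)
open import Data.Product using (_×_; _,_)
open import Data.Fin.Permutation using (Permutation′; _⟨$⟩ʳ_)
open import Relation.Binary.PropositionalEquality using (_≡_)
open import Relation.Nullary using (Dec; yes; no)
open import Relation.Nullary.Decidable using (_→-dec_; _×-dec_)
import Data.Nat as ℕ

allFuns : ∀ n m → List (Fin n → Fin m)
allFuns zero    m = [ (λ ()) ]
allFuns (suc n) m = concatMap (λ f → map (λ x → x ∷ᶠ f) (allFin m)) (allFuns n m)

-- An arrival order of n elements with distinct values: π i = (true rank − 1)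
-- of the element a_{i+1} arriving at time i+1.  Arrival orders are exactly the
-- bijections Fin n → Fin n, i.e. the injective maps.
IsArrivalOrder : ∀ {n} → (Fin n → Fin n) → Set
IsArrivalOrder {n} π = ∀ i j → π i ≡ π j → i ≡ j

isArrivalOrder? : ∀ {n} (π : Fin n → Fin n) → Dec (IsArrivalOrder π)
isArrivalOrder? π = all? λ i → all? λ j → (π i ≟ π j) →-dec (i ≟ j)

arrivalOrders : ∀ n → List (Fin n → Fin n)
arrivalOrders n = filter isArrivalOrder? (allFuns n n)

-- The event O_σ : a_{σ(1)} < a_{σ(2)} < ... < a_{σ(t)}, for a permutation σ of
-- the first t times (t ≤ n).  Values compare as ranks do.
Oσ : ∀ {n t} → t ℕ.≤ n → Permutation′ t → (Fin n → Fin n) → Set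
Oσ {n} {t} t≤n σ π =
  ∀ (i j : Fin t) → i < j →
    π (inject≤ (σ ⟨$⟩ʳ i) t≤n) < π (inject≤ (σ ⟨$⟩ʳ j) t≤n)

Oσ? : ∀ {n t} (t≤n : t ℕ.≤ n) (σ : Permutation′ t) (π : Fin n → Fin n) → Dec (Oσ t≤n σ π)
Oσ? t≤n σ π = all? λ i → all? λ j → (i <? j) →-dec (_ <? _)

-- The event rk(a_t) = r+1, where a_t is the element arriving at time t (index t-1).
RankAt : ∀ {n} → (time : Fin n) → (r : Fin n) → (Fin n → Fin n) → Set
RankAt time r π = π time ≡ r

-- Number of arrival orders in O_σ, and in O_σ ∩ {rk(a_t) = r+1}.
-- Pr(rk(a_t)=r+1 | O_σ) = countJoint / countO.
countO : ∀ {n t} → t ℕ.≤ n → Permutation′ t → ℕ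
countO t≤n σ = length (filter (Oσ? t≤n σ) (arrivalOrders _))

countJoint : ∀ {n t} → t ℕ.≤ n → Permutation′ t → (time r : Fin n) → ℕ
countJoint t≤n σ time r =
  length (filter (λ π → Oσ? t≤n σ π ×-dec (π time ≟ r)) (arrivalOrders _))

-- Conditioned on O_σ, the ranks of the first t arrivals, read in the order σ, form an increasing
-- map h : Fin t → Fin n, and every such h extends to the same number of arrival orders.  Hence,
-- with k = K + 1 and t = K + 1 + T,
--   Pr(rk(a_t) = x + 1 | O_σ) = g x / ∑ g,   where g x = C(x, K) C(n - 1 - x, T)
-- counts the increasing h with h K = x.  Let M maximise g.  The ratio
--   g (x + 1) / g x = (x + 1)(n - 1 - x - T) / ((x + 1 - K)(n - 1 - x)),
-- the maximality of M and the proportions t = c n, k = c′ t show that g loses a factor at most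
-- 1 - 1/(2w) per step on [M, M + w] for some w ≍ √n.  So ∑ g ≥ (w + 1) g M / 2, and
-- g x / ∑ g ≤ 2 / (w + 1) = O(1/√n).
module Submission where

open import Level using (Level)
open import Data.Nat using (ℕ; zero; suc; _+_; _*_; _∸_; _≤_; _<_; z≤n; s≤s; s≤s⁻¹; >-nonZero)
open import Data.Nat.Properties hiding (_≟_)
open import Data.Nat.Combinatorics using (_C_; k>n⇒nCk≡0; nCk+nC[k+1]≡[n+1]C[k+1]; nC1≡n)
open import Data.Nat.Tactic.RingSolver using (solve-∀)
open import Data.Fin using (Fin; toℕ; inject≤) renaming (zero to fzero; suc to fsuc)
import Data.Fin as Fin
open import Data.Fin.Properties using (_≟_; all?; any?)
import Data.Fin.Properties as Finₚ
open import Data.Fin.Subset using (Subset; _∉_; _∪_; ⁅_⁆) renaming (⊥ to ∅)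
open import Data.Fin.Subset.Properties using (_∈?_; x∈p∪q⁻; x∈p∪q⁺; x∈⁅x⁆; x∈⁅y⁆⇒x≡y; ∉⊥)
open import Data.Fin.Permutation using (Permutation′; _⟨$⟩ʳ_; _⟨$⟩ˡ_; inverseˡ)
open import Data.Maybe using (Maybe; just; nothing)
open import Data.Maybe.Properties using (just-injective)
import Data.Maybe.Properties as Maybeₚ
open import Data.List using (List; []; _∷_; _++_; map; concat; concatMap; filter; length; allFin; tabulate)
open import Data.Vec.Functional using () renaming (_∷_ to _∷ᶠ_)
open import Data.Product using (∃; _×_; _,_; proj₁; proj₂)
open import Data.Sum using (_⊎_; inj₁; inj₂)
open import Data.Empty using (⊥; ⊥-elim)
open import Data.Unit using (tt)
open import Function using (_∘_)
open import Relation.Binary using (tri<; tri≈; tri>)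
open import Relation.Binary.PropositionalEquality
open import Relation.Nullary using (Dec; yes; no; ¬_)
open import Relation.Nullary.Decidable using (_×-dec_; _→-dec_; ¬?)
open import Relation.Unary using (Decidable)
open import Defs

private variable
  ℓ ℓ′ ℓ₁ ℓ₂ : Level
  X : Set ℓ₁
  Y : Set ℓ₂
  m n : ℕ

-- Finite sums

𝟙 : Dec X → ℕ
𝟙 (yes _) = 1
𝟙 (no _)  = 0

𝟙-cong : (X → Y) → (Y → X) → (a? : Dec X) (b? : Dec Y) → 𝟙 a? ≡ 𝟙 b?
𝟙-cong f g (yes x) (yes y) = refl
𝟙-cong f g (yes x) (no ¬y) = ⊥-elim (¬y (f x))
𝟙-cong f g (no ¬x) (yes y) = ⊥-elim (¬x (g y))
𝟙-cong f g (no ¬x) (no ¬y) = refl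

𝟙-×-dec : (a? : Dec X) (b? : Dec Y) → 𝟙 (a? ×-dec b?) ≡ 𝟙 a? * 𝟙 b?
𝟙-×-dec (yes _) (yes _) = refl
𝟙-×-dec (yes _) (no _)  = refl
𝟙-×-dec (no _)  _       = refl

𝟙-¬?+𝟙 : (a? : Dec X) → 𝟙 (¬? a?) + 𝟙 a? ≡ 1
𝟙-¬?+𝟙 (yes _) = refl
𝟙-¬?+𝟙 (no _)  = refl

∑ : List X → (X → ℕ) → ℕ
∑ []       f = 0
∑ (x ∷ xs) f = f x + ∑ xs f

∑-cong : ∀ xs {f g : X → ℕ} → (∀ x → f x ≡ g x) → ∑ xs f ≡ ∑ xs g
∑-cong []       f≗g = refl
∑-cong (x ∷ xs) f≗g = cong₂ _+_ (f≗g x) (∑-cong xs f≗g)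

∑-zero : (xs : List X) → ∑ xs (λ _ → 0) ≡ 0
∑-zero []       = refl
∑-zero (x ∷ xs) = ∑-zero xs

∑-++ : ∀ xs ys (f : X → ℕ) → ∑ (xs ++ ys) f ≡ ∑ xs f + ∑ ys f
∑-++ []       ys f = refl
∑-++ (x ∷ xs) ys f = trans (cong (f x +_) (∑-++ xs ys f)) (sym (+-assoc (f x) _ _))

∑-distrib-+ : ∀ xs (f g : X → ℕ) → ∑ xs (λ x → f x + g x) ≡ ∑ xs f + ∑ xs g
∑-distrib-+ []       f g = refl
∑-distrib-+ (x ∷ xs) f g =
  trans (cong (f x + g x +_) (∑-distrib-+ xs f g)) (+-+-transpose (f x) (g x) (∑ xs f) (∑ xs g))
  where
  +-+-transpose : ∀ w x y z → w + x + (y + z) ≡ w + y + (x + z)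
  +-+-transpose w x y z = trans (+-assoc w x (y + z)) (trans (cong (w +_) (+-comm x (y + z)))
    (trans (cong (w +_) (+-assoc y z x)) (trans (cong (λ u → w + (y + u)) (+-comm z x)) (sym (+-assoc w y (x + z))))))

∑-distribˡ-* : ∀ xs c (f : X → ℕ) → ∑ xs (λ x → c * f x) ≡ c * ∑ xs f
∑-distribˡ-* []       c f = sym (*-zeroʳ c)
∑-distribˡ-* (x ∷ xs) c f =
  trans (cong (c * f x +_) (∑-distribˡ-* xs c f)) (sym (*-distribˡ-+ c (f x) (∑ xs f)))

∑-distribʳ-* : ∀ xs c (f : X → ℕ) → ∑ xs (λ x → f x * c) ≡ ∑ xs f * c
∑-distribʳ-* xs c f =
  trans (∑-cong xs (λ x → *-comm (f x) c)) (trans (∑-distribˡ-* xs c f) (*-comm c (∑ xs f)))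

∑-map : (h : X → Y) (xs : List X) (f : Y → ℕ) → ∑ (map h xs) f ≡ ∑ xs (f ∘ h)
∑-map h []       f = refl
∑-map h (x ∷ xs) f = cong (f (h x) +_) (∑-map h xs f)

∑-concatMap : (h : X → List Y) (xs : List X) (f : Y → ℕ) →
  ∑ (concatMap h xs) f ≡ ∑ xs (λ x → ∑ (h x) f)
∑-concatMap h []       f = refl
∑-concatMap h (x ∷ xs) f =
  trans (∑-++ (h x) (concat (map h xs)) f) (cong (∑ (h x) f +_) (∑-concatMap h xs f))

∑-comm : (xs : List X) (ys : List Y) (F : X → Y → ℕ) →
  ∑ xs (λ x → ∑ ys (F x)) ≡ ∑ ys (λ y → ∑ xs (λ x → F x y))
∑-comm []       ys F = sym (∑-zero ys)
∑-comm (x ∷ xs) ys F =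
  trans (cong (∑ ys (F x) +_) (∑-comm xs ys F)) (sym (∑-distrib-+ ys (F x) (λ y → ∑ xs (λ x′ → F x′ y))))

length-filter-filter : ∀ {P : X → Set ℓ} {Q : X → Set ℓ′} (P? : Decidable P) (Q? : Decidable Q) xs →
  length (filter Q? (filter P? xs)) ≡ ∑ xs (λ x → 𝟙 (P? x) * 𝟙 (Q? x))
length-filter-filter P? Q? [] = refl
length-filter-filter P? Q? (x ∷ xs) with P? x
... | no _ = length-filter-filter P? Q? xs
... | yes _ with Q? x
...   | yes _ = cong suc (length-filter-filter P? Q? xs)
...   | no _  = length-filter-filter P? Q? xs

∑-tabulate : ∀ n (g : Fin n → Y) (f : Y → ℕ) → ∑ (tabulate g) f ≡ ∑ (allFin n) (f ∘ g)
∑-tabulate zero    g f = refl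
∑-tabulate (suc n) g f =
  cong (f (g fzero) +_) (trans (∑-tabulate n (g ∘ fsuc) f) (sym (∑-tabulate n fsuc (f ∘ g))))

∑-allFin-suc : ∀ n (f : Fin (suc n) → ℕ) → ∑ (allFin (suc n)) f ≡ f fzero + ∑ (allFin n) (f ∘ fsuc)
∑-allFin-suc n f = cong (f fzero +_) (∑-tabulate n fsuc f)

∑-allFuns-suc : ∀ n m (F : (Fin (suc n) → Fin m) → ℕ) →
  ∑ (allFuns (suc n) m) F ≡ ∑ (allFin m) (λ x → ∑ (allFuns n m) (λ g → F (x ∷ᶠ g)))
∑-allFuns-suc n m F = begin
  ∑ (allFuns (suc n) m) F
    ≡⟨ ∑-concatMap _ (allFuns n m) F ⟩
  ∑ (allFuns n m) (λ g → ∑ (map (_∷ᶠ g) (allFin m)) F)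
    ≡⟨ ∑-cong (allFuns n m) (λ g → ∑-map (_∷ᶠ g) (allFin m) F) ⟩
  ∑ (allFuns n m) (λ g → ∑ (allFin m) (λ x → F (x ∷ᶠ g)))
    ≡⟨ ∑-comm (allFuns n m) (allFin m) _ ⟩
  ∑ (allFin m) (λ x → ∑ (allFuns n m) (λ g → F (x ∷ᶠ g))) ∎
  where open ≡-Reasoning

∑-allFin-1 : ∀ n → ∑ (allFin n) (λ _ → 1) ≡ n
∑-allFin-1 zero    = refl
∑-allFin-1 (suc n) = trans (∑-allFin-suc n (λ _ → 1)) (cong suc (∑-allFin-1 n))

∑-𝟙-≟ : ∀ m (v : Fin m) → ∑ (allFin m) (λ x → 𝟙 (x ≟ v)) ≡ 1
∑-𝟙-≟ (suc m) fzero = begin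
  ∑ (allFin (suc m)) (λ x → 𝟙 (x ≟ fzero))
    ≡⟨ ∑-allFin-suc m (λ x → 𝟙 (x ≟ fzero)) ⟩
  suc (∑ (allFin m) (λ x → 𝟙 (fsuc x ≟ fzero)))
    ≡⟨ cong suc (∑-cong (allFin m) (λ x → 𝟙-cong {Y = ⊥} (λ ()) (λ ()) (fsuc x ≟ fzero) (no λ ()))) ⟩
  suc (∑ (allFin m) (λ _ → 0))
    ≡⟨ cong suc (∑-zero (allFin m)) ⟩
  1 ∎
  where open ≡-Reasoning
∑-𝟙-≟ (suc m) (fsuc v) = begin
  ∑ (allFin (suc m)) (λ x → 𝟙 (x ≟ fsuc v))
    ≡⟨ ∑-allFin-suc m (λ x → 𝟙 (x ≟ fsuc v)) ⟩
  ∑ (allFin m) (λ x → 𝟙 (fsuc x ≟ fsuc v))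
    ≡⟨ ∑-cong (allFin m) (λ x → 𝟙-cong Finₚ.suc-injective (cong fsuc) (fsuc x ≟ fsuc v) (x ≟ v)) ⟩
  ∑ (allFin m) (λ x → 𝟙 (x ≟ v))
    ≡⟨ ∑-𝟙-≟ m v ⟩
  1 ∎
  where open ≡-Reasoning

∑-𝟙-≟ʳ : ∀ m (v : Fin m) → ∑ (allFin m) (λ x → 𝟙 (v ≟ x)) ≡ 1
∑-𝟙-≟ʳ m v = trans (∑-cong (allFin m) (λ x → 𝟙-cong sym sym (v ≟ x) (x ≟ v))) (∑-𝟙-≟ m v)

∑-𝟙-≟-* : ∀ m (v : Fin m) (G : Fin m → ℕ) → ∑ (allFin m) (λ x → 𝟙 (x ≟ v) * G x) ≡ G v
∑-𝟙-≟-* m v G = begin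
  ∑ (allFin m) (λ x → 𝟙 (x ≟ v) * G x)  ≡⟨ ∑-cong (allFin m) only-v ⟩
  ∑ (allFin m) (λ x → 𝟙 (x ≟ v) * G v)  ≡⟨ ∑-distribʳ-* (allFin m) (G v) _ ⟩
  ∑ (allFin m) (λ x → 𝟙 (x ≟ v)) * G v  ≡⟨ cong (_* G v) (∑-𝟙-≟ m v) ⟩
  1 * G v                                ≡⟨ *-identityˡ (G v) ⟩
  G v                                    ∎
  where
  open ≡-Reasoning
  only-v : ∀ x → 𝟙 (x ≟ v) * G x ≡ 𝟙 (x ≟ v) * G v
  only-v x with x ≟ v
  ... | yes refl = refl
  ... | no _     = refl

∑-𝟙-¬? : ∀ n {P : Fin n → Set ℓ} (P? : Decidable P) →
  ∑ (allFin n) (λ x → 𝟙 (¬? (P? x))) ≡ n ∸ ∑ (allFin n) (λ x → 𝟙 (P? x))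
∑-𝟙-¬? n P? = begin
  ∑ (allFin n) (λ x → 𝟙 (¬? (P? x)))
    ≡⟨ m+n∸n≡m _ (#P) ⟨
  ∑ (allFin n) (λ x → 𝟙 (¬? (P? x))) + #P ∸ #P
    ≡⟨ cong (_∸ #P) (∑-distrib-+ (allFin n) _ _) ⟨
  ∑ (allFin n) (λ x → 𝟙 (¬? (P? x)) + 𝟙 (P? x)) ∸ #P
    ≡⟨ cong (_∸ #P) (trans (∑-cong (allFin n) (𝟙-¬?+𝟙 ∘ P?)) (∑-allFin-1 n)) ⟩
  n ∸ #P ∎
  where
  open ≡-Reasoning
  #P = ∑ (allFin n) (λ x → 𝟙 (P? x))

∑-𝟙-remove : ∀ m {P : Fin m → Set ℓ} (P? : Decidable P) {x} → P x →
  ∑ (allFin m) (λ y → 𝟙 (P? y ×-dec ¬? (y ≟ x))) + 1 ≡ ∑ (allFin m) (λ y → 𝟙 (P? y))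
∑-𝟙-remove m P? {x} px = begin
  ∑ (allFin m) (λ y → 𝟙 (P? y ×-dec ¬? (y ≟ x))) + 1
    ≡⟨ cong (∑ (allFin m) (λ y → 𝟙 (P? y ×-dec ¬? (y ≟ x))) +_) (∑-𝟙-≟ m x) ⟨
  ∑ (allFin m) (λ y → 𝟙 (P? y ×-dec ¬? (y ≟ x))) + ∑ (allFin m) (λ y → 𝟙 (y ≟ x))
    ≡⟨ ∑-distrib-+ (allFin m) _ _ ⟨
  ∑ (allFin m) (λ y → 𝟙 (P? y ×-dec ¬? (y ≟ x)) + 𝟙 (y ≟ x))
    ≡⟨ ∑-cong (allFin m) split ⟩
  ∑ (allFin m) (λ y → 𝟙 (P? y)) ∎
  where
  open ≡-Reasoning
  split : ∀ y → 𝟙 (P? y ×-dec ¬? (y ≟ x)) + 𝟙 (y ≟ x) ≡ 𝟙 (P? y)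
  split y with y ≟ x | P? y
  ... | yes refl | yes _  = refl
  ... | yes refl | no ¬px = ⊥-elim (¬px px)
  ... | no _     | yes _  = refl
  ... | no _     | no _   = refl

∑-allFuns-≗ : ∀ t n (f : Fin t → Fin n) → ∑ (allFuns t n) (λ h → 𝟙 (all? λ i → f i ≟ h i)) ≡ 1
∑-allFuns-≗ zero    n f = refl
∑-allFuns-≗ (suc t) n f = begin
  ∑ (allFuns (suc t) n) (λ h → 𝟙 (all? λ i → f i ≟ h i))
    ≡⟨ ∑-allFuns-suc t n _ ⟩
  ∑ (allFin n) (λ x → ∑ (allFuns t n) (λ g → 𝟙 (all? λ i → f i ≟ (x ∷ᶠ g) i)))
    ≡⟨ ∑-cong (allFin n) (λ x → ∑-cong (allFuns t n) (λ g → split x g)) ⟩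
  ∑ (allFin n) (λ x → ∑ (allFuns t n) (λ g → 𝟙 (f fzero ≟ x) * 𝟙 (all? λ i → f (fsuc i) ≟ g i)))
    ≡⟨ ∑-cong (allFin n) (λ x → ∑-distribˡ-* (allFuns t n) (𝟙 (f fzero ≟ x)) _) ⟩
  ∑ (allFin n) (λ x → 𝟙 (f fzero ≟ x) * ∑ (allFuns t n) (λ g → 𝟙 (all? λ i → f (fsuc i) ≟ g i)))
    ≡⟨ ∑-cong (allFin n) (λ x → cong (𝟙 (f fzero ≟ x) *_) (∑-allFuns-≗ t n (f ∘ fsuc))) ⟩
  ∑ (allFin n) (λ x → 𝟙 (f fzero ≟ x) * 1)
    ≡⟨ ∑-cong (allFin n) (λ x → *-identityʳ _) ⟩
  ∑ (allFin n) (λ x → 𝟙 (f fzero ≟ x))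
    ≡⟨ ∑-𝟙-≟ʳ n (f fzero) ⟩
  1 ∎
  where
  open ≡-Reasoning
  split : ∀ x g → 𝟙 (all? λ i → f i ≟ (x ∷ᶠ g) i) ≡ 𝟙 (f fzero ≟ x) * 𝟙 (all? λ i → f (fsuc i) ≟ g i)
  split x g = trans
    (𝟙-cong (λ eq → eq fzero , eq ∘ fsuc) (λ { (eq₀ , eq) fzero → eq₀ ; (eq₀ , eq) (fsuc i) → eq i }) _ _)
    (𝟙-×-dec (f fzero ≟ x) (all? λ i → f (fsuc i) ≟ g i))

∑< : ℕ → (ℕ → ℕ) → ℕ
∑< zero    f = 0
∑< (suc n) f = f 0 + ∑< n (f ∘ suc)

∑-allFin-toℕ : ∀ n (f : ℕ → ℕ) → ∑ (allFin n) (f ∘ toℕ) ≡ ∑< n f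
∑-allFin-toℕ zero    f = refl
∑-allFin-toℕ (suc n) f = trans (∑-allFin-suc n (f ∘ toℕ)) (cong (f 0 +_) (∑-allFin-toℕ n (f ∘ suc)))

∑<-cong : ∀ n {f g : ℕ → ℕ} → (∀ x → f x ≡ g x) → ∑< n f ≡ ∑< n g
∑<-cong zero    f≗g = refl
∑<-cong (suc n) f≗g = cong₂ _+_ (f≗g 0) (∑<-cong n (f≗g ∘ suc))

∑<-zero : ∀ n → ∑< n (λ _ → 0) ≡ 0
∑<-zero zero    = refl
∑<-zero (suc n) = ∑<-zero n

∑<-distribˡ-* : ∀ n c (f : ℕ → ℕ) → ∑< n (λ x → c * f x) ≡ c * ∑< n f
∑<-distribˡ-* zero    c f = sym (*-zeroʳ c)
∑<-distribˡ-* (suc n) c f =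
  trans (cong (c * f 0 +_) (∑<-distribˡ-* n c (f ∘ suc))) (sym (*-distribˡ-+ c (f 0) _))

∑<-distribʳ-* : ∀ n c (f : ℕ → ℕ) → ∑< n (λ x → f x * c) ≡ ∑< n f * c
∑<-distribʳ-* n c f =
  trans (∑<-cong n (λ x → *-comm (f x) c)) (trans (∑<-distribˡ-* n c f) (*-comm c (∑< n f)))

∑<-+ : ∀ m n (f : ℕ → ℕ) → ∑< (m + n) f ≡ ∑< m f + ∑< n (λ j → f (m + j))
∑<-+ zero    n f = refl
∑<-+ (suc m) n f = trans (cong (f 0 +_) (∑<-+ m n (f ∘ suc))) (sym (+-assoc (f 0) _ _))

∑<-window : ∀ n m c (f : ℕ → ℕ) → m + c ≤ n → ∑< c (λ j → f (m + j)) ≤ ∑< n f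
∑<-window n m c f m+c≤n = begin
  ∑< c (λ j → f (m + j))                                  ≤⟨ m≤n+m _ (∑< m f) ⟩
  ∑< m f + ∑< c (λ j → f (m + j))                         ≡⟨ ∑<-+ m c f ⟨
  ∑< (m + c) f                                            ≤⟨ m≤m+n _ _ ⟩
  ∑< (m + c) f + ∑< (n ∸ (m + c)) (λ j → f (m + c + j))   ≡⟨ ∑<-+ (m + c) (n ∸ (m + c)) f ⟨
  ∑< (m + c + (n ∸ (m + c))) f                            ≡⟨ cong (λ z → ∑< z f) (m+[n∸m]≡n m+c≤n) ⟩
  ∑< n f                                                  ∎
  where open ≤-Reasoning

∑<-term : ∀ n x (f : ℕ → ℕ) → x < n → f x ≤ ∑< n f
∑<-term n x f x<n = subst (_≤ ∑< n f) (trans (+-identityʳ _) (cong f (+-identityʳ x)))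
  (∑<-window n x 1 f (subst (_≤ n) (+-comm 1 x) x<n))

∑<-lowerBound : ∀ c b (f : ℕ → ℕ) → (∀ j → j < c → b ≤ f j) → c * b ≤ ∑< c f
∑<-lowerBound zero    b f _    = z≤n
∑<-lowerBound (suc c) b f b≤f =
  +-mono-≤ (b≤f 0 (s≤s z≤n)) (∑<-lowerBound c b (f ∘ suc) (λ j j<c → b≤f (suc j) (s≤s j<c)))

∑<-𝟙-< : ∀ n r → r ≤ n → (f : ℕ → ℕ) → ∑< n (λ x → 𝟙 (suc x ≤? r) * f x) ≡ ∑< r f
∑<-𝟙-< n       zero    _           f = ∑<-zero n
∑<-𝟙-< (suc n) (suc r) (s≤s r≤n) f = cong₂ _+_ (+-identityʳ (f 0))
  (trans (∑<-cong n (λ x → cong (_* f (suc x)) (𝟙-cong s≤s⁻¹ s≤s (suc (suc x) ≤? suc r) (suc x ≤? r))))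
         (∑<-𝟙-< n r r≤n (f ∘ suc)))

-- Binomial coefficients

C-pos : ∀ {n k} → k ≤ n → 0 < n C k
C-pos {n} {zero} _ = s≤s z≤n
C-pos {suc n} {suc k} (s≤s k≤n) =
  subst (0 <_) (nCk+nC[k+1]≡[n+1]C[k+1] n k) (<-≤-trans (C-pos k≤n) (m≤m+n _ _))

∑<-hockeyStick : ∀ k r lo → ∑< r (λ x → 𝟙 (lo ≤? x) * ((r ∸ 1 ∸ x) C k)) ≡ (r ∸ lo) C suc k
∑<-hockeyStick k zero    lo       = cong (_C suc k) (sym (0∸n≡0 lo))
∑<-hockeyStick k (suc r) zero     = trans
  (cong₂ _+_ (+-identityʳ (r C k))
    (trans (∑<-cong r (λ x → cong₂ _*_ (𝟙-cong (λ _ → z≤n) (λ _ → z≤n) (0 ≤? suc x) (0 ≤? x))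
                                        (cong (_C k) (sym (∸-+-assoc r 1 x)))))
           (∑<-hockeyStick k r zero)))
  (nCk+nC[k+1]≡[n+1]C[k+1] r k)
∑<-hockeyStick k (suc r) (suc lo) = trans
  (∑<-cong r (λ x → cong₂ _*_ (𝟙-cong s≤s⁻¹ s≤s (suc lo ≤? suc x) (lo ≤? x))
                              (cong (_C k) (sym (∸-+-assoc r 1 x)))))
  (∑<-hockeyStick k r lo)

C-absorption : ∀ n k → (suc n C suc k) * suc k ≡ suc n * (n C k)
C-absorption n zero = begin
  (suc n C 1) * 1  ≡⟨ *-identityʳ (suc n C 1) ⟩
  suc n C 1        ≡⟨ nC1≡n (suc n) ⟩
  suc n            ≡⟨ *-identityʳ (suc n) ⟨
  suc n * 1        ∎
  where open ≡-Reasoning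
C-absorption zero (suc k) = refl
C-absorption (suc n) (suc k) = begin
  (suc (suc n) C suc (suc k)) * suc (suc k)
    ≡⟨ cong (_* suc (suc k)) (nCk+nC[k+1]≡[n+1]C[k+1] (suc n) (suc k)) ⟨
  (U + V) * suc (suc k)
    ≡⟨ distrib U V k ⟩
  U * suc k + V * suc (suc k) + U
    ≡⟨ cong₂ (λ u v → u + v + U) (C-absorption n k) (C-absorption n (suc k)) ⟩
  suc n * (n C k) + suc n * (n C suc k) + U
    ≡⟨ cong (_+ U) (*-distribˡ-+ (suc n) (n C k) (n C suc k)) ⟨
  suc n * ((n C k) + (n C suc k)) + U
    ≡⟨ cong (λ z → suc n * z + U) (nCk+nC[k+1]≡[n+1]C[k+1] n k) ⟩
  suc n * U + U
    ≡⟨ +-comm (suc n * U) U ⟩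
  suc (suc n) * U ∎
  where
  open ≡-Reasoning
  U = suc n C suc k
  V = suc n C suc (suc k)
  distrib : ∀ U V k → (U + V) * suc (suc k) ≡ U * suc k + V * suc (suc k) + U
  distrib = solve-∀

[1+r]CK*[1+r∸K]≡rCK*[1+r] : ∀ r K → (suc r C K) * (suc r ∸ K) ≡ (r C K) * suc r
[1+r]CK*[1+r∸K]≡rCK*[1+r] r zero = refl
[1+r]CK*[1+r∸K]≡rCK*[1+r] r (suc k) with k ≤? r
... | no k≰r = begin
  (suc r C suc k) * (suc r ∸ suc k)  ≡⟨ cong ((suc r C suc k) *_) (m≤n⇒m∸n≡0 r≤k) ⟩
  (suc r C suc k) * 0                ≡⟨ *-zeroʳ (suc r C suc k) ⟩
  0                                  ≡⟨ cong (_* suc r) (k>n⇒nCk≡0 (s≤s r≤k)) ⟨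
  (r C suc k) * suc r                ∎
  where
  open ≡-Reasoning
  r≤k = <⇒≤ (≰⇒> k≰r)
... | yes k≤r = +-cancelˡ-≡ (U * suc k) _ _ (begin
  U * suc k + U * (r ∸ k)                 ≡⟨ *-distribˡ-+ U (suc k) (r ∸ k) ⟨
  U * (suc k + (r ∸ k))                   ≡⟨ cong (λ z → U * suc z) (m+[n∸m]≡n k≤r) ⟩
  U * suc r                               ≡⟨ cong (_* suc r) (nCk+nC[k+1]≡[n+1]C[k+1] r k) ⟨
  ((r C k) + (r C suc k)) * suc r         ≡⟨ *-distribʳ-+ (suc r) (r C k) (r C suc k) ⟩
  (r C k) * suc r + (r C suc k) * suc r   ≡⟨ cong (_+ (r C suc k) * suc r) absorbed ⟩
  U * suc k + (r C suc k) * suc r         ∎)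
  where
  open ≡-Reasoning
  U = suc r C suc k
  absorbed : (r C k) * suc r ≡ U * suc k
  absorbed = trans (*-comm (r C k) (suc r)) (sym (C-absorption r k))

[m∸1]CT*m≡mCT*[m∸T] : ∀ m T → ((m ∸ 1) C T) * m ≡ (m C T) * (m ∸ T)
[m∸1]CT*m≡mCT*[m∸T] zero    T = begin
  (0 C T) * 0        ≡⟨ *-zeroʳ (0 C T) ⟩
  0                  ≡⟨ *-zeroʳ (0 C T) ⟨
  (0 C T) * 0        ≡⟨ cong ((0 C T) *_) (0∸n≡0 T) ⟨
  (0 C T) * (0 ∸ T)  ∎
  where open ≡-Reasoning
[m∸1]CT*m≡mCT*[m∸T] (suc m) T = sym ([1+r]CK*[1+r∸K]≡rCK*[1+r] m T)

-- Injective completions of a partial injection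

IsInjection : (Fin n → Fin m) → Set
IsInjection π = ∀ i j → π i ≡ π j → i ≡ j

isInjection? : (π : Fin n → Fin m) → Dec (IsInjection π)
isInjection? π = all? λ i → all? λ j → (π i ≟ π j) →-dec (i ≟ j)

module _ {x : Fin m} {g : Fin n → Fin m} where

  ∷-isInjection : IsInjection g → (∀ i → g i ≢ x) → IsInjection (x ∷ᶠ g)
  ∷-isInjection g-inj x∉g fzero    fzero    _  = refl
  ∷-isInjection g-inj x∉g fzero    (fsuc j) eq = ⊥-elim (x∉g j (sym eq))
  ∷-isInjection g-inj x∉g (fsuc i) fzero    eq = ⊥-elim (x∉g i eq)
  ∷-isInjection g-inj x∉g (fsuc i) (fsuc j) eq = cong fsuc (g-inj i j eq)

  tail-isInjection : IsInjection (x ∷ᶠ g) → IsInjection g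
  tail-isInjection inj i j eq = Finₚ.suc-injective (inj (fsuc i) (fsuc j) eq)

  head∉tail : IsInjection (x ∷ᶠ g) → ∀ i → g i ≢ x
  head∉tail inj i eq with inj fzero (fsuc i) (sym eq)
  ... | ()

Partial : ℕ → ℕ → Set
Partial n m = Fin n → Maybe (Fin m)

_≟ₘ_ : (u v : Maybe (Fin m)) → Dec (u ≡ v)
_≟ₘ_ = Maybeₚ.≡-dec _≟_

Extends : Partial n m → (Fin n → Fin m) → Set
Extends A π = ∀ i v → A i ≡ just v → π i ≡ v

Avoids : Subset m → (Fin n → Fin m) → Set
Avoids B π = ∀ i → π i ∉ B

IsCompletion : Partial n m → Subset m → (Fin n → Fin m) → Set
IsCompletion A B π = IsInjection π × Extends A π × Avoids B π

isCompletion? : (A : Partial n m) (B : Subset m) (π : Fin n → Fin m) → Dec (IsCompletion A B π)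
isCompletion? A B π =
  isInjection? π ×-dec (all? λ i → all? λ v → (A i ≟ₘ just v) →-dec (π i ≟ v)) ×-dec (all? λ i → ¬? (π i ∈? B))

InImage : Partial n m → Fin m → Set
InImage A v = ∃ λ i → A i ≡ just v

IsFree : Partial n m → Subset m → Fin m → Set
IsFree A B v = v ∉ B × ¬ InImage A v

isFree? : (A : Partial n m) (B : Subset m) (v : Fin m) → Dec (IsFree A B v)
isFree? A B v = ¬? (v ∈? B) ×-dec ¬? (any? λ i → A i ≟ₘ just v)

#free : Partial n m → Subset m → ℕ
#free {m = m} A B = ∑ (allFin m) (𝟙 ∘ isFree? A B)

#undefined : Partial n m → ℕ
#undefined {n} A = ∑ (allFin n) (λ i → 𝟙 (A i ≟ₘ nothing))

IsPartialInjection : Partial n m → Set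
IsPartialInjection A = ∀ i j v → A i ≡ just v → A j ≡ just v → i ≡ j

Disjoint : Partial n m → Subset m → Set
Disjoint A B = ∀ i v → A i ≡ just v → v ∉ B

nothing≢just : ∀ {x : Fin m} → nothing ≢ just x
nothing≢just ()

fallingFactorial : ℕ → ℕ → ℕ
fallingFactorial a zero    = 1
fallingFactorial a (suc d) = a * fallingFactorial (a ∸ 1) d

∉-∪⁅⁆⁻ : ∀ {B : Subset m} {x y} → y ∉ B ∪ ⁅ x ⁆ → y ∉ B × y ≢ x
∉-∪⁅⁆⁻ {B = B} {x} y∉ = (λ y∈B → y∉ (x∈p∪q⁺ (inj₁ y∈B))) , (λ { refl → y∉ (x∈p∪q⁺ (inj₂ (x∈⁅x⁆ x))) })

∉-∪⁅⁆⁺ : ∀ {B : Subset m} {x y} → y ∉ B → y ≢ x → y ∉ B ∪ ⁅ x ⁆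
∉-∪⁅⁆⁺ {B = B} {x} y∉B y≢x y∈ with x∈p∪q⁻ B ⁅ x ⁆ y∈
... | inj₁ y∈B = y∉B y∈B
... | inj₂ y∈x = y≢x (x∈⁅y⁆⇒x≡y x y∈x)

module _ (A : Partial n m) (B : Subset m) (x : Fin m) where

  isFree-∪⁅⁆⁻ : ∀ {y} → IsFree A (B ∪ ⁅ x ⁆) y → IsFree A B y × y ≢ x
  isFree-∪⁅⁆⁻ (y∉ , y∉A) = (proj₁ (∉-∪⁅⁆⁻ y∉) , y∉A) , proj₂ (∉-∪⁅⁆⁻ {B = B} y∉)

  isFree-∪⁅⁆⁺ : ∀ {y} → IsFree A B y × y ≢ x → IsFree A (B ∪ ⁅ x ⁆) y
  isFree-∪⁅⁆⁺ ((y∉B , y∉A) , y≢x) = ∉-∪⁅⁆⁺ y∉B y≢x , y∉A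

-- The admissible values at fzero of a completion of A avoiding B.
IsHead : Partial (suc n) m → Subset m → Fin m → Set
IsHead A B x = (∀ v → A fzero ≡ just v → x ≡ v) × x ∉ B × ¬ InImage (A ∘ fsuc) x

isHead? : (A : Partial (suc n) m) (B : Subset m) (x : Fin m) → Dec (IsHead A B x)
isHead? A B x =
  (all? λ v → (A fzero ≟ₘ just v) →-dec (x ≟ v)) ×-dec ¬? (x ∈? B) ×-dec ¬? (any? λ i → A (fsuc i) ≟ₘ just x)

module _ (A : Partial (suc n) m) (B : Subset m) (x : Fin m) (g : Fin n → Fin m) where

  isCompletion-∷⁻ : IsCompletion A B (x ∷ᶠ g) → IsHead A B x × IsCompletion (A ∘ fsuc) (B ∪ ⁅ x ⁆) g
  isCompletion-∷⁻ (inj , ext , avoids) =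
    (ext fzero , avoids fzero , x∉A′) ,
    tail-isInjection inj , (ext ∘ fsuc) , (λ i → ∉-∪⁅⁆⁺ (avoids (fsuc i)) (head∉tail inj i))
    where
    x∉A′ : ¬ InImage (A ∘ fsuc) x
    x∉A′ (i , Ai≡x) = head∉tail inj i (ext (fsuc i) x Ai≡x)

  isCompletion-∷⁺ : IsHead A B x × IsCompletion (A ∘ fsuc) (B ∪ ⁅ x ⁆) g → IsCompletion A B (x ∷ᶠ g)
  isCompletion-∷⁺ ((x-ext , x∉B , _) , inj , ext , avoids) =
    ∷-isInjection inj (proj₂ ∘ g-avoids) , ext′ , avoids′
    where
    g-avoids : ∀ i → g i ∉ B × g i ≢ x
    g-avoids i = ∉-∪⁅⁆⁻ (avoids i)
    ext′ : Extends A (x ∷ᶠ g)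
    ext′ fzero    = x-ext
    ext′ (fsuc i) = ext i
    avoids′ : Avoids B (x ∷ᶠ g)
    avoids′ fzero    = x∉B
    avoids′ (fsuc i) = proj₁ (g-avoids i)

#completions : Partial n m → Subset m → ℕ
#completions {n} {m} A B = ∑ (allFuns n m) (𝟙 ∘ isCompletion? A B)

#completions-suc : (A : Partial (suc n) m) (B : Subset m) →
  #completions A B ≡ ∑ (allFin m) (λ x → 𝟙 (isHead? A B x) * #completions (A ∘ fsuc) (B ∪ ⁅ x ⁆))
#completions-suc {n} {m} A B = trans (∑-allFuns-suc n m _) (∑-cong (allFin m) λ x →
  trans (∑-cong (allFuns n m) (λ g →
          trans (𝟙-cong (isCompletion-∷⁻ A B x g) (isCompletion-∷⁺ A B x g) _ (isHead? A B x ×-dec isCompletion? _ _ g))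
                (𝟙-×-dec (isHead? A B x) _)))
        (∑-distribˡ-* (allFuns n m) (𝟙 (isHead? A B x)) _))

module _ (A : Partial (suc n) m) (B : Subset m) where

  private
    A′ = A ∘ fsuc

  isPartialInjection-tail : IsPartialInjection A → IsPartialInjection A′
  isPartialInjection-tail inj i j v eqᵢ eqⱼ = Finₚ.suc-injective (inj (fsuc i) (fsuc j) v eqᵢ eqⱼ)

  disjoint-tail : Disjoint A B → ∀ {x} → IsHead A B x → Disjoint A′ (B ∪ ⁅ x ⁆)
  disjoint-tail disj (_ , _ , x∉A′) i w eq = ∉-∪⁅⁆⁺ (disj (fsuc i) w eq) (λ { refl → x∉A′ (i , eq) })

  #undefined-suc : #undefined A ≡ 𝟙 (A fzero ≟ₘ nothing) + #undefined A′
  #undefined-suc = ∑-allFin-suc n (λ i → 𝟙 (A i ≟ₘ nothing))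

  module _ {v} (A₀≡v : A fzero ≡ just v) where

    just-isHead⁻ : ∀ {x} → IsHead A B x → x ≡ v
    just-isHead⁻ (x-ext , _) = x-ext v A₀≡v

    just-isHead⁺ : IsPartialInjection A → Disjoint A B → ∀ {x} → x ≡ v → IsHead A B x
    just-isHead⁺ inj disj refl =
      (λ w eq → just-injective (trans (sym A₀≡v) eq)) , disj fzero v A₀≡v ,
      λ { (i , eq) → Finₚ.0≢1+n (inj fzero (fsuc i) v A₀≡v eq) }

    just-isFree⁻ : ∀ {y} → IsFree A′ (B ∪ ⁅ v ⁆) y → IsFree A B y
    just-isFree⁻ free with isFree-∪⁅⁆⁻ A′ B v free
    ... | (y∉B , y∉A′) , y≢v = y∉B , λ
      { (fzero , eq)  → y≢v (just-injective (trans (sym eq) A₀≡v))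
      ; (fsuc i , eq) → y∉A′ (i , eq) }

    just-isFree⁺ : ∀ {y} → IsFree A B y → IsFree A′ (B ∪ ⁅ v ⁆) y
    just-isFree⁺ (y∉B , y∉A) = isFree-∪⁅⁆⁺ A′ B v ((y∉B , λ { (i , eq) → y∉A (fsuc i , eq) }) ,
      λ { refl → y∉A (fzero , A₀≡v) })

  module _ (A₀≡nothing : A fzero ≡ nothing) where

    nothing-isHead⁻ : ∀ {x} → IsHead A B x → IsFree A B x
    nothing-isHead⁻ (_ , x∉B , x∉A′) = x∉B , λ
      { (fzero , eq)  → ⊥-elim (nothing≢just (trans (sym A₀≡nothing) eq))
      ; (fsuc i , eq) → x∉A′ (i , eq) }

    nothing-isHead⁺ : ∀ {x} → IsFree A B x → IsHead A B x
    nothing-isHead⁺ (x∉B , x∉A) =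
      (λ w eq → ⊥-elim (nothing≢just (trans (sym A₀≡nothing) eq))) , x∉B , (λ { (i , eq) → x∉A (fsuc i , eq) })

    nothing-isFree⁻ : ∀ {x y} → IsFree A′ (B ∪ ⁅ x ⁆) y → IsFree A B y × y ≢ x
    nothing-isFree⁻ {x} free with isFree-∪⁅⁆⁻ A′ B x free
    ... | (y∉B , y∉A′) , y≢x = (y∉B , λ
      { (fzero , eq)  → ⊥-elim (nothing≢just (trans (sym A₀≡nothing) eq))
      ; (fsuc i , eq) → y∉A′ (i , eq) }) , y≢x

    nothing-isFree⁺ : ∀ {x y} → IsFree A B y × y ≢ x → IsFree A′ (B ∪ ⁅ x ⁆) y
    nothing-isFree⁺ {x} ((y∉B , y∉A) , y≢x) = isFree-∪⁅⁆⁺ A′ B x ((y∉B , λ { (i , eq) → y∉A (fsuc i , eq) }) , y≢x)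

  module _ (inj : IsPartialInjection A) (disj : Disjoint A B)
           (ih : ∀ B′ → Disjoint A′ B′ → #completions A′ B′ ≡ fallingFactorial (#free A′ B′) (#undefined A′)) where

    #completions-just : ∀ {v} → A fzero ≡ just v → #completions A B ≡ fallingFactorial (#free A B) (#undefined A)
    #completions-just {v} A₀≡v = begin
      #completions A B
        ≡⟨ #completions-suc A B ⟩
      ∑ (allFin m) (λ x → 𝟙 (isHead? A B x) * #completions A′ (B ∪ ⁅ x ⁆))
        ≡⟨ ∑-cong (allFin m) (λ x → cong (_* #completions A′ (B ∪ ⁅ x ⁆)) (head⇔≡v x)) ⟩
      ∑ (allFin m) (λ x → 𝟙 (x ≟ v) * #completions A′ (B ∪ ⁅ x ⁆))
        ≡⟨ ∑-𝟙-≟-* m v _ ⟩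
      #completions A′ (B ∪ ⁅ v ⁆)
        ≡⟨ ih (B ∪ ⁅ v ⁆) (disjoint-tail disj (just-isHead⁺ A₀≡v inj disj refl)) ⟩
      fallingFactorial (#free A′ (B ∪ ⁅ v ⁆)) (#undefined A′)
        ≡⟨ cong₂ fallingFactorial #free-eq (sym #undefined-eq) ⟩
      fallingFactorial (#free A B) (#undefined A) ∎
      where
      open ≡-Reasoning
      head⇔≡v : ∀ x → 𝟙 (isHead? A B x) ≡ 𝟙 (x ≟ v)
      head⇔≡v x = 𝟙-cong (just-isHead⁻ A₀≡v) (just-isHead⁺ A₀≡v inj disj) (isHead? A B x) (x ≟ v)
      #free-eq : #free A′ (B ∪ ⁅ v ⁆) ≡ #free A B
      #free-eq = ∑-cong (allFin m) (λ y → 𝟙-cong (just-isFree⁻ A₀≡v) (just-isFree⁺ A₀≡v) _ _)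
      #undefined-eq : #undefined A ≡ #undefined A′
      #undefined-eq = trans #undefined-suc (cong (λ a → 𝟙 (a ≟ₘ nothing) + #undefined A′) A₀≡v)

    #completions-nothing : A fzero ≡ nothing → #completions A B ≡ fallingFactorial (#free A B) (#undefined A)
    #completions-nothing A₀≡nothing = begin
      #completions A B
        ≡⟨ #completions-suc A B ⟩
      ∑ (allFin m) (λ x → 𝟙 (isHead? A B x) * #completions A′ (B ∪ ⁅ x ⁆))
        ≡⟨ ∑-cong (allFin m) (λ x → completions-at x (isHead? A B x)) ⟩
      ∑ (allFin m) (λ x → 𝟙 (isFree? A B x) * c)
        ≡⟨ ∑-distribʳ-* (allFin m) c _ ⟩
      #free A B * c
        ≡⟨ cong (fallingFactorial (#free A B)) #undefined-eq ⟨
      fallingFactorial (#free A B) (#undefined A) ∎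
      where
      open ≡-Reasoning
      c = fallingFactorial (#free A B ∸ 1) (#undefined A′)
      #undefined-eq : #undefined A ≡ suc (#undefined A′)
      #undefined-eq = trans #undefined-suc (cong (λ a → 𝟙 (a ≟ₘ nothing) + #undefined A′) A₀≡nothing)
      #free-tail : ∀ {x} → IsFree A B x → #free A′ (B ∪ ⁅ x ⁆) ≡ #free A B ∸ 1
      #free-tail {x} x-free = begin
        #free A′ (B ∪ ⁅ x ⁆)
          ≡⟨ ∑-cong (allFin m) (λ y → 𝟙-cong (nothing-isFree⁻ A₀≡nothing) (nothing-isFree⁺ A₀≡nothing) _ (isFree? A B y ×-dec ¬? (y ≟ x))) ⟩
        ∑ (allFin m) (λ y → 𝟙 (isFree? A B y ×-dec ¬? (y ≟ x)))
          ≡⟨ m+n∸n≡m _ 1 ⟨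
        ∑ (allFin m) (λ y → 𝟙 (isFree? A B y ×-dec ¬? (y ≟ x))) + 1 ∸ 1
          ≡⟨ cong (_∸ 1) (∑-𝟙-remove m (isFree? A B) x-free) ⟩
        #free A B ∸ 1 ∎
      completions-at : ∀ x (head? : Dec (IsHead A B x)) →
        𝟙 head? * #completions A′ (B ∪ ⁅ x ⁆) ≡ 𝟙 (isFree? A B x) * c
      completions-at x (no ¬head) =
        sym (cong (_* c) (𝟙-cong (¬head ∘ nothing-isHead⁺ A₀≡nothing) (λ ()) (isFree? A B x) (no λ ())))
      completions-at x (yes head) = begin
        1 * #completions A′ (B ∪ ⁅ x ⁆)
          ≡⟨ cong (1 *_) (ih (B ∪ ⁅ x ⁆) (disjoint-tail disj head)) ⟩
        1 * fallingFactorial (#free A′ (B ∪ ⁅ x ⁆)) (#undefined A′)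
          ≡⟨ cong (λ a → 1 * fallingFactorial a (#undefined A′)) (#free-tail free) ⟩
        1 * c
          ≡⟨ cong (_* c) (𝟙-cong (λ _ → free) (λ _ → tt) (yes tt) (isFree? A B x)) ⟩
        𝟙 (isFree? A B x) * c ∎
        where free = nothing-isHead⁻ A₀≡nothing head

#completions≡fallingFactorial : (A : Partial n m) (B : Subset m) → IsPartialInjection A → Disjoint A B →
  #completions A B ≡ fallingFactorial (#free A B) (#undefined A)
#completions≡fallingFactorial {zero} A B _ _ =
  trans (+-identityʳ _) (𝟙-cong _ (λ _ → (λ ()) , (λ ()) , (λ ())) (isCompletion? A B (λ ())) (yes tt))
#completions≡fallingFactorial {suc n} A B inj disj = by-cases (A fzero) refl
  where
  ih : ∀ B′ → Disjoint (A ∘ fsuc) B′ →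
    #completions (A ∘ fsuc) B′ ≡ fallingFactorial (#free (A ∘ fsuc) B′) (#undefined (A ∘ fsuc))
  ih B′ = #completions≡fallingFactorial (A ∘ fsuc) B′ (isPartialInjection-tail A B inj)
  by-cases : ∀ a → A fzero ≡ a → #completions A B ≡ fallingFactorial (#free A B) (#undefined A)
  by-cases (just v) A₀≡v       = #completions-just A B inj disj ih A₀≡v
  by-cases nothing  A₀≡nothing = #completions-nothing A B inj disj ih A₀≡nothing

𝟙-any?-≡-∑ : ∀ t (h : Fin t → Fin n) → IsInjection h → ∀ v →
  𝟙 (any? λ i → h i ≟ v) ≡ ∑ (allFin t) (λ i → 𝟙 (h i ≟ v))
𝟙-any?-≡-∑ zero    h inj v = refl
𝟙-any?-≡-∑ (suc t) h inj v = trans (by-head (h fzero ≟ v)) (sym (∑-allFin-suc t (λ i → 𝟙 (h i ≟ v))))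
  where
  tail-inj : IsInjection (h ∘ fsuc)
  tail-inj i j eq = Finₚ.suc-injective (inj (fsuc i) (fsuc j) eq)
  by-head : (h₀? : Dec (h fzero ≡ v)) →
    𝟙 (any? λ i → h i ≟ v) ≡ 𝟙 h₀? + ∑ (allFin t) (λ i → 𝟙 (h (fsuc i) ≟ v))
  by-head (yes h₀≡v) = begin
    𝟙 (any? λ i → h i ≟ v)                      ≡⟨ 𝟙-cong (λ _ → h₀≡v) (λ _ → fzero , h₀≡v) _ (yes h₀≡v) ⟩
    1                                          ≡⟨ cong suc (∑-zero (allFin t)) ⟨
    1 + ∑ (allFin t) (λ _ → 0)                 ≡⟨ cong suc (∑-cong (allFin t) not-hit) ⟨
    1 + ∑ (allFin t) (λ i → 𝟙 (h (fsuc i) ≟ v)) ∎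
    where
    open ≡-Reasoning
    not-hit : ∀ i → 𝟙 (h (fsuc i) ≟ v) ≡ 0
    not-hit i = 𝟙-cong (λ hᵢ≡v → Finₚ.0≢1+n (inj fzero (fsuc i) (trans h₀≡v (sym hᵢ≡v)))) (λ ()) (h (fsuc i) ≟ v) (no λ ())
  by-head (no h₀≢v) = trans
    (𝟙-cong (λ { (fzero , eq) → ⊥-elim (h₀≢v eq) ; (fsuc i , eq) → i , eq }) (λ (i , eq) → fsuc i , eq)
            _ (any? λ i → h (fsuc i) ≟ v))
    (𝟙-any?-≡-∑ t (h ∘ fsuc) tail-inj v)

#image : ∀ t n (h : Fin t → Fin n) → IsInjection h → ∑ (allFin n) (λ v → 𝟙 (any? λ i → h i ≟ v)) ≡ t
#image t n h inj = begin
  ∑ (allFin n) (λ v → 𝟙 (any? λ i → h i ≟ v))             ≡⟨ ∑-cong (allFin n) (𝟙-any?-≡-∑ t h inj) ⟩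
  ∑ (allFin n) (λ v → ∑ (allFin t) (λ i → 𝟙 (h i ≟ v)))   ≡⟨ ∑-comm (allFin n) (allFin t) _ ⟩
  ∑ (allFin t) (λ i → ∑ (allFin n) (λ v → 𝟙 (h i ≟ v)))   ≡⟨ ∑-cong (allFin t) (λ i → ∑-𝟙-≟ʳ n (h i)) ⟩
  ∑ (allFin t) (λ _ → 1)                                  ≡⟨ ∑-allFin-1 t ⟩
  t                                                       ∎
  where open ≡-Reasoning

-- Increasing maps

IsIncreasing : (Fin m → Fin n) → Set
IsIncreasing h = ∀ i j → i Fin.< j → h i Fin.< h j

isIncreasing? : (h : Fin m → Fin n) → Dec (IsIncreasing h)
isIncreasing? h = all? λ i → all? λ j → (i Finₚ.<? j) →-dec (h i Finₚ.<? h j)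

IsIncreasingFrom : ℕ → (Fin m → Fin n) → Set
IsIncreasingFrom lo h = IsIncreasing h × (∀ i → lo ≤ toℕ (h i))

isIncreasingFrom? : ∀ lo (h : Fin m → Fin n) → Dec (IsIncreasingFrom lo h)
isIncreasingFrom? lo h = isIncreasing? h ×-dec all? λ i → lo ≤? toℕ (h i)

module _ {lo : ℕ} {x : Fin n} {g : Fin m → Fin n} where

  isIncreasingFrom-∷⁻ : IsIncreasingFrom lo (x ∷ᶠ g) → lo ≤ toℕ x × IsIncreasingFrom (suc (toℕ x)) g
  isIncreasingFrom-∷⁻ (incr , above) =
    above fzero , (λ i j i<j → incr (fsuc i) (fsuc j) (s≤s i<j)) , (λ i → incr fzero (fsuc i) (s≤s z≤n))

  isIncreasingFrom-∷⁺ : lo ≤ toℕ x × IsIncreasingFrom (suc (toℕ x)) g → IsIncreasingFrom lo (x ∷ᶠ g)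
  isIncreasingFrom-∷⁺ (lo≤x , incr , above) = incr′ , above′
    where
    incr′ : IsIncreasing (x ∷ᶠ g)
    incr′ fzero    (fsuc j) _         = above j
    incr′ (fsuc i) (fsuc j) (s≤s i<j) = incr i j i<j
    above′ : ∀ i → lo ≤ toℕ ((x ∷ᶠ g) i)
    above′ fzero    = lo≤x
    above′ (fsuc i) = ≤-trans lo≤x (<⇒≤ (above i))

𝟙-isIncreasingFrom-∷ : ∀ lo (x : Fin n) (g : Fin m → Fin n) →
  𝟙 (isIncreasingFrom? lo (x ∷ᶠ g)) ≡ 𝟙 (lo ≤? toℕ x) * 𝟙 (isIncreasingFrom? (suc (toℕ x)) g)
𝟙-isIncreasingFrom-∷ lo x g =
  trans (𝟙-cong isIncreasingFrom-∷⁻ isIncreasingFrom-∷⁺ _ _) (𝟙-×-dec (lo ≤? toℕ x) _)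

#increasingFrom : ∀ n a lo → ∑ (allFuns a n) (𝟙 ∘ isIncreasingFrom? lo) ≡ (n ∸ lo) C a
#increasingFrom n zero lo =
  trans (+-identityʳ _) (𝟙-cong _ (λ _ → (λ ()) , (λ ())) (isIncreasingFrom? {0} {n} lo (λ ())) (yes tt))
#increasingFrom n (suc a) lo = begin
  ∑ (allFuns (suc a) n) (𝟙 ∘ isIncreasingFrom? lo)
    ≡⟨ ∑-allFuns-suc a n _ ⟩
  ∑ (allFin n) (λ x → ∑ (allFuns a n) (λ g → 𝟙 (isIncreasingFrom? lo (x ∷ᶠ g))))
    ≡⟨ ∑-cong (allFin n) (λ x → ∑-cong (allFuns a n) (𝟙-isIncreasingFrom-∷ lo x)) ⟩
  ∑ (allFin n) (λ x → ∑ (allFuns a n) (λ g → 𝟙 (lo ≤? toℕ x) * 𝟙 (isIncreasingFrom? (suc (toℕ x)) g)))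
    ≡⟨ ∑-cong (allFin n) (λ x → ∑-distribˡ-* (allFuns a n) (𝟙 (lo ≤? toℕ x)) _) ⟩
  ∑ (allFin n) (λ x → 𝟙 (lo ≤? toℕ x) * ∑ (allFuns a n) (𝟙 ∘ isIncreasingFrom? (suc (toℕ x))))
    ≡⟨ ∑-cong (allFin n) (λ x → cong (𝟙 (lo ≤? toℕ x) *_) (#increasingFrom n a (suc (toℕ x)))) ⟩
  ∑ (allFin n) (λ x → 𝟙 (lo ≤? toℕ x) * ((n ∸ suc (toℕ x)) C a))
    ≡⟨ ∑-allFin-toℕ n (λ x → 𝟙 (lo ≤? x) * ((n ∸ suc x) C a)) ⟩
  ∑< n (λ x → 𝟙 (lo ≤? x) * ((n ∸ suc x) C a))
    ≡⟨ ∑<-cong n (λ x → cong (λ z → 𝟙 (lo ≤? x) * (z C a)) (sym (∸-+-assoc n 1 x))) ⟩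
  ∑< n (λ x → 𝟙 (lo ≤? x) * ((n ∸ 1 ∸ x) C a))
    ≡⟨ ∑<-hockeyStick a n lo ⟩
  (n ∸ lo) C suc a ∎
  where open ≡-Reasoning

#increasingFrom-at : ∀ n a (k : Fin a) lo (r : Fin n) →
  ∑ (allFuns a n) (λ h → 𝟙 (isIncreasingFrom? lo h ×-dec h k ≟ r))
    ≡ 𝟙 (lo ≤? toℕ r) * ((toℕ r ∸ lo) C toℕ k) * ((n ∸ suc (toℕ r)) C (a ∸ suc (toℕ k)))
#increasingFrom-at n (suc a) fzero lo r = begin
  ∑ (allFuns (suc a) n) (λ h → 𝟙 (isIncreasingFrom? lo h ×-dec h fzero ≟ r))
    ≡⟨ ∑-allFuns-suc a n _ ⟩
  ∑ (allFin n) (λ x → ∑ (allFuns a n) (λ g → 𝟙 (isIncreasingFrom? lo (x ∷ᶠ g) ×-dec x ≟ r)))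
    ≡⟨ ∑-cong (allFin n) (λ x → ∑-cong (allFuns a n) (split x)) ⟩
  ∑ (allFin n) (λ x → ∑ (allFuns a n) (λ g → 𝟙 (x ≟ r) * 𝟙 (lo ≤? toℕ x) * 𝟙 (isIncreasingFrom? (suc (toℕ x)) g)))
    ≡⟨ ∑-cong (allFin n) (λ x → ∑-distribˡ-* (allFuns a n) (𝟙 (x ≟ r) * 𝟙 (lo ≤? toℕ x)) _) ⟩
  ∑ (allFin n) (λ x → 𝟙 (x ≟ r) * 𝟙 (lo ≤? toℕ x) * ∑ (allFuns a n) (𝟙 ∘ isIncreasingFrom? (suc (toℕ x))))
    ≡⟨ ∑-cong (allFin n) (λ x → trans (cong (𝟙 (x ≟ r) * 𝟙 (lo ≤? toℕ x) *_) (#increasingFrom n a (suc (toℕ x))))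
                                      (*-assoc (𝟙 (x ≟ r)) _ _)) ⟩
  ∑ (allFin n) (λ x → 𝟙 (x ≟ r) * (𝟙 (lo ≤? toℕ x) * ((n ∸ suc (toℕ x)) C a)))
    ≡⟨ ∑-𝟙-≟-* n r (λ x → 𝟙 (lo ≤? toℕ x) * ((n ∸ suc (toℕ x)) C a)) ⟩
  𝟙 (lo ≤? toℕ r) * ((n ∸ suc (toℕ r)) C a)
    ≡⟨ cong (_* ((n ∸ suc (toℕ r)) C a)) (*-identityʳ (𝟙 (lo ≤? toℕ r))) ⟨
  𝟙 (lo ≤? toℕ r) * 1 * ((n ∸ suc (toℕ r)) C a) ∎
  where
  open ≡-Reasoning
  split : ∀ x g → 𝟙 (isIncreasingFrom? lo (x ∷ᶠ g) ×-dec x ≟ r)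
                ≡ 𝟙 (x ≟ r) * 𝟙 (lo ≤? toℕ x) * 𝟙 (isIncreasingFrom? (suc (toℕ x)) g)
  split x g = begin
    𝟙 (isIncreasingFrom? lo (x ∷ᶠ g) ×-dec x ≟ r)
      ≡⟨ 𝟙-×-dec (isIncreasingFrom? lo (x ∷ᶠ g)) (x ≟ r) ⟩
    𝟙 (isIncreasingFrom? lo (x ∷ᶠ g)) * 𝟙 (x ≟ r)
      ≡⟨ *-comm _ (𝟙 (x ≟ r)) ⟩
    𝟙 (x ≟ r) * 𝟙 (isIncreasingFrom? lo (x ∷ᶠ g))
      ≡⟨ cong (𝟙 (x ≟ r) *_) (𝟙-isIncreasingFrom-∷ lo x g) ⟩
    𝟙 (x ≟ r) * (𝟙 (lo ≤? toℕ x) * 𝟙 (isIncreasingFrom? (suc (toℕ x)) g))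
      ≡⟨ *-assoc (𝟙 (x ≟ r)) _ _ ⟨
    𝟙 (x ≟ r) * 𝟙 (lo ≤? toℕ x) * 𝟙 (isIncreasingFrom? (suc (toℕ x)) g) ∎
#increasingFrom-at n (suc a) (fsuc k) lo r = begin
  ∑ (allFuns (suc a) n) (λ h → 𝟙 (isIncreasingFrom? lo h ×-dec h (fsuc k) ≟ r))
    ≡⟨ ∑-allFuns-suc a n _ ⟩
  ∑ (allFin n) (λ x → ∑ (allFuns a n) (λ g → 𝟙 (isIncreasingFrom? lo (x ∷ᶠ g) ×-dec g k ≟ r)))
    ≡⟨ ∑-cong (allFin n) (λ x → ∑-cong (allFuns a n) (split x)) ⟩
  ∑ (allFin n) (λ x → ∑ (allFuns a n) (λ g → 𝟙 (lo ≤? toℕ x) * 𝟙 (isIncreasingFrom? (suc (toℕ x)) g ×-dec g k ≟ r)))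
    ≡⟨ ∑-cong (allFin n) (λ x → ∑-distribˡ-* (allFuns a n) (𝟙 (lo ≤? toℕ x)) _) ⟩
  ∑ (allFin n) (λ x → 𝟙 (lo ≤? toℕ x) * ∑ (allFuns a n) (λ g → 𝟙 (isIncreasingFrom? (suc (toℕ x)) g ×-dec g k ≟ r)))
    ≡⟨ ∑-cong (allFin n) (λ x → cong (𝟙 (lo ≤? toℕ x) *_) (#increasingFrom-at n a k (suc (toℕ x)) r)) ⟩
  ∑ (allFin n) (λ x → 𝟙 (lo ≤? toℕ x) * (𝟙 (suc (toℕ x) ≤? toℕ r) * ((toℕ r ∸ suc (toℕ x)) C toℕ k) * Z))
    ≡⟨ ∑-allFin-toℕ n (λ x → 𝟙 (lo ≤? x) * (𝟙 (suc x ≤? toℕ r) * ((toℕ r ∸ suc x) C toℕ k) * Z)) ⟩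
  ∑< n (λ x → 𝟙 (lo ≤? x) * (𝟙 (suc x ≤? toℕ r) * ((toℕ r ∸ suc x) C toℕ k) * Z))
    ≡⟨ ∑<-cong n reorder ⟩
  ∑< n (λ x → 𝟙 (suc x ≤? toℕ r) * (𝟙 (lo ≤? x) * ((toℕ r ∸ 1 ∸ x) C toℕ k)) * Z)
    ≡⟨ ∑<-distribʳ-* n Z _ ⟩
  ∑< n (λ x → 𝟙 (suc x ≤? toℕ r) * (𝟙 (lo ≤? x) * ((toℕ r ∸ 1 ∸ x) C toℕ k))) * Z
    ≡⟨ cong (_* Z) (∑<-𝟙-< n (toℕ r) (<⇒≤ (Finₚ.toℕ<n r)) _) ⟩
  ∑< (toℕ r) (λ x → 𝟙 (lo ≤? x) * ((toℕ r ∸ 1 ∸ x) C toℕ k)) * Z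
    ≡⟨ cong (_* Z) (∑<-hockeyStick (toℕ k) (toℕ r) lo) ⟩
  ((toℕ r ∸ lo) C suc (toℕ k)) * Z
    ≡⟨ cong (_* Z) (vanishes-below-lo (lo ≤? toℕ r)) ⟩
  𝟙 (lo ≤? toℕ r) * ((toℕ r ∸ lo) C suc (toℕ k)) * Z ∎
  where
  open ≡-Reasoning
  Z = (n ∸ suc (toℕ r)) C (a ∸ suc (toℕ k))
  split : ∀ x g → 𝟙 (isIncreasingFrom? lo (x ∷ᶠ g) ×-dec g k ≟ r)
                ≡ 𝟙 (lo ≤? toℕ x) * 𝟙 (isIncreasingFrom? (suc (toℕ x)) g ×-dec g k ≟ r)
  split x g = trans
    (𝟙-cong (λ (incr , eq) → proj₁ (isIncreasingFrom-∷⁻ incr) , proj₂ (isIncreasingFrom-∷⁻ incr) , eq)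
            (λ (lo≤x , incr , eq) → isIncreasingFrom-∷⁺ (lo≤x , incr) , eq) _ ((lo ≤? toℕ x) ×-dec _))
    (𝟙-×-dec (lo ≤? toℕ x) _)
  reorder : ∀ x → 𝟙 (lo ≤? x) * (𝟙 (suc x ≤? toℕ r) * ((toℕ r ∸ suc x) C toℕ k) * Z)
                ≡ 𝟙 (suc x ≤? toℕ r) * (𝟙 (lo ≤? x) * ((toℕ r ∸ 1 ∸ x) C toℕ k)) * Z
  reorder x = trans (rearrange (𝟙 (lo ≤? x)) (𝟙 (suc x ≤? toℕ r)) _ Z)
    (cong (λ z → 𝟙 (suc x ≤? toℕ r) * (𝟙 (lo ≤? x) * (z C toℕ k)) * Z) (sym (∸-+-assoc (toℕ r) 1 x)))
    where
    rearrange : ∀ a b c d → a * (b * c * d) ≡ b * (a * c) * d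
    rearrange = solve-∀
  vanishes-below-lo : (lo≤r? : Dec (lo ≤ toℕ r)) →
    (toℕ r ∸ lo) C suc (toℕ k) ≡ 𝟙 lo≤r? * ((toℕ r ∸ lo) C suc (toℕ k))
  vanishes-below-lo (yes _)   = sym (+-identityʳ _)
  vanishes-below-lo (no lo≰r) rewrite m≤n⇒m∸n≡0 (<⇒≤ (≰⇒> lo≰r)) = refl

isIncreasing⇒isInjection : ∀ {t n} (h : Fin t → Fin n) → IsIncreasing h → IsInjection h
isIncreasing⇒isInjection h incr i j eq with Finₚ.<-cmp i j
... | tri< i<j _ _ = ⊥-elim (<-irrefl (cong toℕ eq) (incr i j i<j))
... | tri≈ _ i≡j _ = i≡j
... | tri> _ _ j<i = ⊥-elim (<-irrefl (cong toℕ (sym eq)) (incr j i j<i))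

-- Arrival orders with prescribed ranks at the first t times

-- The number of increasing maps Fin (K + 1 + T) → Fin n sending K to x.
profile : ℕ → ℕ → ℕ → ℕ → ℕ
profile n K T x = (x C K) * ((n ∸ suc x) C T)

module Restriction {t n} (e : Fin t → Fin n) (e-inj : IsInjection e) where

  along : (Fin t → Fin n) → Partial n n
  along h p with any? (λ i → e i ≟ p)
  ... | yes (i , _) = just (h i)
  ... | no _        = nothing

  along-e : ∀ h i → along h (e i) ≡ just (h i)
  along-e h i with any? (λ j → e j ≟ e i)
  ... | yes (j , eⱼ≡eᵢ) = cong (just ∘ h) (e-inj j i eⱼ≡eᵢ)
  ... | no ∄j          = ⊥-elim (∄j (i , refl))

  along-just : ∀ h p v → along h p ≡ just v → ∃ λ i → e i ≡ p × h i ≡ v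
  along-just h p v eq with any? (λ i → e i ≟ p)
  along-just h p v refl | yes (i , eᵢ≡p) = i , eᵢ≡p , refl

  along-nothing⁻ : ∀ h p → along h p ≡ nothing → ¬ ∃ λ i → e i ≡ p
  along-nothing⁻ h p eq (i , refl) = nothing≢just (trans (sym eq) (along-e h i))

  along-nothing⁺ : ∀ h p → ¬ (∃ λ i → e i ≡ p) → along h p ≡ nothing
  along-nothing⁺ h p ∄i with any? (λ i → e i ≟ p)
  ... | yes found = ⊥-elim (∄i found)
  ... | no _      = refl

  #outside : ℕ
  #outside = ∑ (allFin n) (λ p → 𝟙 (¬? (any? λ i → e i ≟ p)))

  -- The number of arrival orders agreeing with a given injective h on the image of e;
  -- it cancels in the conditional probability.
  completionsPerKey : ℕ
  completionsPerKey = fallingFactorial (n ∸ t) #outside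

  #completions-along : ∀ h → IsInjection h → #completions (along h) ∅ ≡ completionsPerKey
  #completions-along h h-inj =
    trans (#completions≡fallingFactorial (along h) ∅ partialInjection (λ _ v _ → ∉⊥))
          (cong₂ fallingFactorial #free-eq #undefined-eq)
    where
    partialInjection : IsPartialInjection (along h)
    partialInjection p p′ v eq eq′ with along-just h p v eq | along-just h p′ v eq′
    ... | i , refl , hᵢ≡v | i′ , refl , hᵢ′≡v = cong e (h-inj i i′ (trans hᵢ≡v (sym hᵢ′≡v)))
    #free-eq : #free (along h) ∅ ≡ n ∸ t
    #free-eq = begin
      #free (along h) ∅
        ≡⟨ ∑-cong (allFin n) (λ v → 𝟙-cong
             (λ (_ , ∉along) (i , hᵢ≡v) → ∉along (e i , trans (along-e h i) (cong just hᵢ≡v)))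
             (λ ∉h → ∉⊥ , λ (p , eq) → let (i , _ , hᵢ≡v) = along-just h p v eq in ∉h (i , hᵢ≡v))
             _ (¬? (any? λ i → h i ≟ v))) ⟩
      ∑ (allFin n) (λ v → 𝟙 (¬? (any? λ i → h i ≟ v)))
        ≡⟨ ∑-𝟙-¬? n (λ v → any? λ i → h i ≟ v) ⟩
      n ∸ ∑ (allFin n) (λ v → 𝟙 (any? λ i → h i ≟ v))
        ≡⟨ cong (n ∸_) (#image t n h h-inj) ⟩
      n ∸ t ∎
      where open ≡-Reasoning
    #undefined-eq : #undefined (along h) ≡ #outside
    #undefined-eq = ∑-cong (allFin n) (λ p → 𝟙-cong (along-nothing⁻ h p) (along-nothing⁺ h p) _ _)

  restrict : ∀ k r h π →
    𝟙 (isInjection? π) * 𝟙 (isIncreasing? (π ∘ e) ×-dec π (e k) ≟ r) * 𝟙 (all? λ i → π (e i) ≟ h i)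
      ≡ 𝟙 (isIncreasingFrom? 0 h ×-dec h k ≟ r) * 𝟙 (isCompletion? (along h) ∅ π)
  restrict k r h π = begin
    𝟙 inj? * 𝟙 (incr? ×-dec hit?) * 𝟙 key?
      ≡⟨ cong (λ z → z * 𝟙 key?) (𝟙-×-dec inj? (incr? ×-dec hit?)) ⟨
    𝟙 (inj? ×-dec incr? ×-dec hit?) * 𝟙 key?
      ≡⟨ 𝟙-×-dec (inj? ×-dec incr? ×-dec hit?) key? ⟨
    𝟙 ((inj? ×-dec incr? ×-dec hit?) ×-dec key?)
      ≡⟨ 𝟙-cong to from _ ((isIncreasingFrom? 0 h ×-dec h k ≟ r) ×-dec isCompletion? (along h) ∅ π) ⟩
    𝟙 ((isIncreasingFrom? 0 h ×-dec h k ≟ r) ×-dec isCompletion? (along h) ∅ π)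
      ≡⟨ 𝟙-×-dec (isIncreasingFrom? 0 h ×-dec h k ≟ r) (isCompletion? (along h) ∅ π) ⟩
    𝟙 (isIncreasingFrom? 0 h ×-dec h k ≟ r) * 𝟙 (isCompletion? (along h) ∅ π) ∎
    where
    open ≡-Reasoning
    inj? = isInjection? π
    incr? = isIncreasing? (π ∘ e)
    hit? = π (e k) ≟ r
    key? = all? λ i → π (e i) ≟ h i
    to : (IsInjection π × IsIncreasing (π ∘ e) × π (e k) ≡ r) × (∀ i → π (e i) ≡ h i) →
         (IsIncreasingFrom 0 h × h k ≡ r) × IsCompletion (along h) ∅ π
    to ((inj , incr , hit) , πe≗h) =
      ((incr′ , λ _ → z≤n) , trans (sym (πe≗h k)) hit) , inj , extends , λ _ → ∉⊥
      where
      incr′ : IsIncreasing h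
      incr′ i j i<j = subst₂ Fin._<_ (πe≗h i) (πe≗h j) (incr i j i<j)
      extends : Extends (along h) π
      extends p v eq with along-just h p v eq
      ... | i , refl , refl = πe≗h i
    from : (IsIncreasingFrom 0 h × h k ≡ r) × IsCompletion (along h) ∅ π →
           (IsInjection π × IsIncreasing (π ∘ e) × π (e k) ≡ r) × (∀ i → π (e i) ≡ h i)
    from (((incr , _) , hₖ≡r) , inj , extends , _) =
      (inj , (λ i j i<j → subst₂ Fin._<_ (sym (πe≗h i)) (sym (πe≗h j)) (incr i j i<j)) , trans (πe≗h k) hₖ≡r) , πe≗h
      where
      πe≗h : ∀ i → π (e i) ≡ h i
      πe≗h i = extends (e i) (h i) (along-e h i)

  #joint : ∀ k r →
    ∑ (allFuns n n) (λ π → 𝟙 (isInjection? π) * 𝟙 (isIncreasing? (π ∘ e) ×-dec π (e k) ≟ r))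
      ≡ profile n (toℕ k) (t ∸ suc (toℕ k)) (toℕ r) * completionsPerKey
  #joint k r = begin
    ∑ (allFuns n n) W
      ≡⟨ ∑-cong (allFuns n n) (λ π → trans (cong (W π *_) (∑-allFuns-≗ t n (π ∘ e))) (*-identityʳ (W π))) ⟨
    ∑ (allFuns n n) (λ π → W π * ∑ (allFuns t n) (λ h → 𝟙 (key? π h)))
      ≡⟨ ∑-cong (allFuns n n) (λ π → ∑-distribˡ-* (allFuns t n) (W π) _) ⟨
    ∑ (allFuns n n) (λ π → ∑ (allFuns t n) (λ h → W π * 𝟙 (key? π h)))
      ≡⟨ ∑-comm (allFuns n n) (allFuns t n) _ ⟩
    ∑ (allFuns t n) (λ h → ∑ (allFuns n n) (λ π → W π * 𝟙 (key? π h)))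
      ≡⟨ ∑-cong (allFuns t n) (λ h → ∑-cong (allFuns n n) (restrict k r h)) ⟩
    ∑ (allFuns t n) (λ h → ∑ (allFuns n n) (λ π → 𝟙 (D? h) * 𝟙 (isCompletion? (along h) ∅ π)))
      ≡⟨ ∑-cong (allFuns t n) (λ h → ∑-distribˡ-* (allFuns n n) (𝟙 (D? h)) _) ⟩
    ∑ (allFuns t n) (λ h → 𝟙 (D? h) * #completions (along h) ∅)
      ≡⟨ ∑-cong (allFuns t n) (λ h → per-key h (D? h)) ⟩
    ∑ (allFuns t n) (λ h → 𝟙 (D? h) * completionsPerKey)
      ≡⟨ ∑-distribʳ-* (allFuns t n) completionsPerKey _ ⟩
    ∑ (allFuns t n) (𝟙 ∘ D?) * completionsPerKey
      ≡⟨ cong (_* completionsPerKey) (#increasingFrom-at n t k 0 r) ⟩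
    1 * ((toℕ r ∸ 0) C toℕ k) * ((n ∸ suc (toℕ r)) C (t ∸ suc (toℕ k))) * completionsPerKey
      ≡⟨ cong (λ z → z * ((n ∸ suc (toℕ r)) C (t ∸ suc (toℕ k))) * completionsPerKey) (*-identityˡ (toℕ r C toℕ k)) ⟩
    profile n (toℕ k) (t ∸ suc (toℕ k)) (toℕ r) * completionsPerKey ∎
    where
    open ≡-Reasoning
    W : (Fin n → Fin n) → ℕ
    W π = 𝟙 (isInjection? π) * 𝟙 (isIncreasing? (π ∘ e) ×-dec π (e k) ≟ r)
    key? : ∀ π h → Dec (∀ i → π (e i) ≡ h i)
    key? π h = all? λ i → π (e i) ≟ h i
    D? : ∀ h → Dec (IsIncreasingFrom 0 h × h k ≡ r)
    D? h = isIncreasingFrom? 0 h ×-dec h k ≟ r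
    per-key : ∀ h (d? : Dec (IsIncreasingFrom 0 h × h k ≡ r)) →
      𝟙 d? * #completions (along h) ∅ ≡ 𝟙 d? * completionsPerKey
    per-key h (yes ((incr , _) , _)) = cong (1 *_) (#completions-along h (isIncreasing⇒isInjection h incr))
    per-key h (no _)                 = refl

  #total : ∀ k →
    ∑ (allFuns n n) (λ π → 𝟙 (isInjection? π) * 𝟙 (isIncreasing? (π ∘ e)))
      ≡ ∑< n (profile n (toℕ k) (t ∸ suc (toℕ k))) * completionsPerKey
  #total k = begin
    ∑ (allFuns n n) (λ π → 𝟙 (isInjection? π) * 𝟙 (isIncreasing? (π ∘ e)))
      ≡⟨ ∑-cong (allFuns n n) split-by-rank ⟩
    ∑ (allFuns n n) (λ π → ∑ (allFin n) (λ r → 𝟙 (isInjection? π) * 𝟙 (isIncreasing? (π ∘ e) ×-dec π (e k) ≟ r)))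
      ≡⟨ ∑-comm (allFuns n n) (allFin n) _ ⟩
    ∑ (allFin n) (λ r → ∑ (allFuns n n) (λ π → 𝟙 (isInjection? π) * 𝟙 (isIncreasing? (π ∘ e) ×-dec π (e k) ≟ r)))
      ≡⟨ ∑-cong (allFin n) (#joint k) ⟩
    ∑ (allFin n) (λ r → profile n (toℕ k) (t ∸ suc (toℕ k)) (toℕ r) * completionsPerKey)
      ≡⟨ ∑-allFin-toℕ n (λ x → profile n (toℕ k) (t ∸ suc (toℕ k)) x * completionsPerKey) ⟩
    ∑< n (λ x → profile n (toℕ k) (t ∸ suc (toℕ k)) x * completionsPerKey)
      ≡⟨ ∑<-distribʳ-* n completionsPerKey _ ⟩
    ∑< n (profile n (toℕ k) (t ∸ suc (toℕ k))) * completionsPerKey ∎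
    where
    open ≡-Reasoning
    split-by-rank : ∀ π → 𝟙 (isInjection? π) * 𝟙 (isIncreasing? (π ∘ e))
      ≡ ∑ (allFin n) (λ r → 𝟙 (isInjection? π) * 𝟙 (isIncreasing? (π ∘ e) ×-dec π (e k) ≟ r))
    split-by-rank π = begin
      c
        ≡⟨ *-identityʳ c ⟨
      c * 1
        ≡⟨ cong (c *_) (∑-𝟙-≟ʳ n (π (e k))) ⟨
      c * ∑ (allFin n) (λ r → 𝟙 (π (e k) ≟ r))
        ≡⟨ ∑-distribˡ-* (allFin n) c _ ⟨
      ∑ (allFin n) (λ r → c * 𝟙 (π (e k) ≟ r))
        ≡⟨ ∑-cong (allFin n) (λ r → trans (*-assoc (𝟙 (isInjection? π)) _ _)
             (cong (𝟙 (isInjection? π) *_) (sym (𝟙-×-dec (isIncreasing? (π ∘ e)) (π (e k) ≟ r))))) ⟩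
      ∑ (allFin n) (λ r → 𝟙 (isInjection? π) * 𝟙 (isIncreasing? (π ∘ e) ×-dec π (e k) ≟ r)) ∎
      where c = 𝟙 (isInjection? π) * 𝟙 (isIncreasing? (π ∘ e))

-- Concentration of the profile

*-positive : ∀ {m n} → 0 < m → 0 < n → 0 < m * n
*-positive {suc m} {suc n} _ _ = s≤s z≤n

m≤m*n′ : ∀ m {n} → 0 < n → m ≤ m * n
m≤m*n′ m {suc n} _ = m≤m*n m (suc n)

ratio⇒slowDecay : ∀ gx gx′ P Q w t → gx′ * P ≡ gx * Q → P ≤ Q + w * t → 2 * w * w * t ≤ P → 0 < P → 0 < w →
  gx * (2 * w ∸ 1) ≤ gx′ * (2 * w)
ratio⇒slowDecay gx gx′ P Q w t ratio P≤Q+wt 2w²t≤P P>0 w>0 =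
  *-cancelʳ-≤ (gx * (2 * w ∸ 1)) (gx′ * (2 * w)) P {{>-nonZero P>0}}
    (+-cancelʳ-≤ (gx * P) (gx * (2 * w ∸ 1) * P) (gx′ * (2 * w) * P) (begin
      gx * (2 * w ∸ 1) * P + gx * P              ≡⟨ e₁ gx (2 * w ∸ 1) P ⟩
      gx * P * (2 * w ∸ 1 + 1)                   ≡⟨ cong (gx * P *_) (m∸n+n≡m {2 * w} {1} (≤-trans w>0 (m≤m+n w (w + 0)))) ⟩
      gx * P * (2 * w)                           ≤⟨ *-monoˡ-≤ (2 * w) (*-monoʳ-≤ gx P≤Q+wt) ⟩
      gx * (Q + w * t) * (2 * w)                 ≡⟨ e₂ gx Q w t ⟩
      gx * Q * (2 * w) + gx * (2 * w * w * t)    ≡⟨ cong (λ z → z * (2 * w) + gx * (2 * w * w * t)) ratio ⟨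
      gx′ * P * (2 * w) + gx * (2 * w * w * t)   ≤⟨ +-monoʳ-≤ (gx′ * P * (2 * w)) (*-monoʳ-≤ gx 2w²t≤P) ⟩
      gx′ * P * (2 * w) + gx * P                 ≡⟨ cong (_+ gx * P) (e₃ gx′ P w) ⟩
      gx′ * (2 * w) * P + gx * P                 ∎))
  where
  open ≤-Reasoning
  e₁ : ∀ a b c → a * b * c + a * c ≡ a * c * (b + 1)
  e₁ = solve-∀
  e₂ : ∀ gx Q w t → gx * (Q + w * t) * (2 * w) ≡ gx * Q * (2 * w) + gx * (2 * w * w * t)
  e₂ = solve-∀
  e₃ : ∀ a P w → a * P * (2 * w) ≡ a * (2 * w) * P
  e₃ = solve-∀

SlowlyDecaying : (ℕ → ℕ) → ℕ → Set
SlowlyDecaying h w = ∀ i → i < w → h i * (2 * w ∸ 1) ≤ h (suc i) * (2 * w)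

-- (1 - 1/(2w))^j ≥ 1 - j/(2w), in integer form.
slowDecay⇒linearBound : ∀ h w → 0 < w → SlowlyDecaying h w → ∀ j → j ≤ w → (2 * w ∸ j) * h 0 ≤ 2 * w * h j
slowDecay⇒linearBound h w w>0 decay zero    _    = ≤-refl
slowDecay⇒linearBound h w w>0 decay (suc j) j<w =
  *-cancelˡ-≤ (2 * w) {{>-nonZero (*-positive {2} (s≤s z≤n) w>0)}} (begin
    2 * w * ((2 * w ∸ suc j) * h 0)      ≡⟨ *-assoc (2 * w) _ (h 0) ⟨
    2 * w * (2 * w ∸ suc j) * h 0        ≤⟨ *-monoˡ-≤ (h 0) shrink ⟩
    (2 * w ∸ 1) * (2 * w ∸ j) * h 0      ≡⟨ *-assoc (2 * w ∸ 1) _ (h 0) ⟩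
    (2 * w ∸ 1) * ((2 * w ∸ j) * h 0)    ≤⟨ *-monoʳ-≤ (2 * w ∸ 1) (slowDecay⇒linearBound h w w>0 decay j (<⇒≤ j<w)) ⟩
    (2 * w ∸ 1) * (2 * w * h j)          ≡⟨ e (2 * w ∸ 1) (2 * w) (h j) ⟩
    2 * w * (h j * (2 * w ∸ 1))          ≤⟨ *-monoʳ-≤ (2 * w) (decay j j<w) ⟩
    2 * w * (h (suc j) * (2 * w))        ≡⟨ cong (2 * w *_) (*-comm (h (suc j)) (2 * w)) ⟩
    2 * w * (2 * w * h (suc j))          ∎)
  where
  open ≤-Reasoning
  e : ∀ a b c → a * (b * c) ≡ b * (c * a)
  e = solve-∀
  d = 2 * w ∸ suc j
  2w≡d+1+j : 2 * w ≡ d + suc j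
  2w≡d+1+j = sym (m∸n+n≡m (≤-trans j<w (m≤m+n w (w + 0))))
  shrink : 2 * w * d ≤ (2 * w ∸ 1) * (2 * w ∸ j)
  shrink = begin
    2 * w * d               ≡⟨ cong (_* d) 2w≡d+1+j ⟩
    (d + suc j) * d         ≤⟨ m≤m+n _ j ⟩
    (d + suc j) * d + j     ≡⟨ e′ d j ⟩
    (d + j) * (d + 1)       ≡⟨ cong₂ _*_ (sym 2w∸1≡d+j) (sym 2w∸j≡d+1) ⟩
    (2 * w ∸ 1) * (2 * w ∸ j) ∎
    where
    e′ : ∀ d j → (d + suc j) * d + j ≡ (d + j) * (d + 1)
    e′ = solve-∀
    2w∸1≡d+j : 2 * w ∸ 1 ≡ d + j
    2w∸1≡d+j = trans (cong (_∸ 1) 2w≡d+1+j) (cong (_∸ 1) (+-suc d j))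
    2w∸j≡d+1 : 2 * w ∸ j ≡ d + 1
    2w∸j≡d+1 = trans (cong (_∸ j) (trans 2w≡d+1+j (sym (+-assoc d 1 j)))) (m+n∸n≡m (d + 1) j)

slowDecay⇒half : ∀ h w → 0 < w → SlowlyDecaying h w → ∀ j → j ≤ w → h 0 ≤ 2 * h j
slowDecay⇒half h w w>0 decay j j≤w = *-cancelˡ-≤ w {{>-nonZero w>0}} (begin
  w * h 0               ≤⟨ *-monoˡ-≤ (h 0) w≤2w∸j ⟩
  (2 * w ∸ j) * h 0     ≤⟨ slowDecay⇒linearBound h w w>0 decay j j≤w ⟩
  2 * w * h j           ≡⟨ e w (h j) ⟩
  w * (2 * h j)         ∎)
  where
  open ≤-Reasoning
  e : ∀ w x → 2 * w * x ≡ w * (2 * x)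
  e = solve-∀
  w≤2w∸j : w ≤ 2 * w ∸ j
  w≤2w∸j = begin
    w                ≡⟨ m+n∸n≡m w j ⟨
    w + j ∸ j        ≤⟨ ∸-monoˡ-≤ j (+-monoʳ-≤ w (≤-trans j≤w (m≤m+n w 0))) ⟩
    w + (w + 0) ∸ j  ∎

∃-isqrt : ∀ n W → 0 < W → ∃ λ w → w * w * W ≤ n × n < suc w * suc w * W
∃-isqrt zero    W W>0 = 0 , z≤n , subst (0 <_) (sym (+-identityʳ W)) W>0
∃-isqrt (suc n) W W>0 with ∃-isqrt n W W>0
... | w , lo , hi with suc w * suc w * W ≤? suc n
...   | no  w+1-too-big = w , ≤-trans lo (n≤1+n n) , ≰⇒> w+1-too-big
...   | yes w+1-fits    = suc w , w+1-fits , <-≤-trans (s≤s hi) grow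
  where
  open ≤-Reasoning
  e : ∀ w W → suc (suc w) * suc (suc w) * W ≡ suc w * suc w * W + (3 + 2 * w) * W
  e = solve-∀
  grow : suc (suc w * suc w * W) ≤ suc (suc w) * suc (suc w) * W
  grow = begin
    suc (suc w * suc w * W)                      ≡⟨ +-comm 1 _ ⟩
    suc w * suc w * W + 1                        ≤⟨ +-monoʳ-≤ (suc w * suc w * W) (≤-trans W>0 (m≤n*m W (3 + 2 * w))) ⟩
    suc w * suc w * W + (3 + 2 * w) * W          ≡⟨ e w W ⟨
    suc (suc w) * suc (suc w) * W                ∎

argmax : ∀ (f : ℕ → ℕ) N → ∃ λ M → M ≤ N × (∀ x → x ≤ N → f x ≤ f M)
argmax f zero    = 0 , z≤n , λ x x≤0 → ≤-reflexive (cong f (n≤0⇒n≡0 x≤0))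
argmax f (suc N) with argmax f N
... | M , M≤N , max with f (suc N) ≤? f M
...   | yes fN≤fM = M , m≤n⇒m≤1+n M≤N , λ x x≤N+1 → case x (m≤n⇒m<n∨m≡n x≤N+1)
  where case : ∀ x → x < suc N ⊎ x ≡ suc N → f x ≤ f M
        case x (inj₁ x<N+1) = max x (s≤s⁻¹ x<N+1)
        case x (inj₂ refl)  = fN≤fM
...   | no fN≰fM  = suc N , ≤-refl , λ x x≤N+1 → case x (m≤n⇒m<n∨m≡n x≤N+1)
  where case : ∀ x → x < suc N ⊎ x ≡ suc N → f x ≤ f (suc N)
        case x (inj₁ x<N+1) = ≤-trans (max x (s≤s⁻¹ x<N+1)) (<⇒≤ (≰⇒> fN≰fM))
        case x (inj₂ refl)  = ≤-refl

module _ (n K T : ℕ) where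

  private
    g = profile n K T

  profile-ratio : ∀ x → g (suc x) * ((suc x ∸ K) * (n ∸ suc x)) ≡ g x * (suc x * (n ∸ suc x ∸ T))
  profile-ratio x = begin
    (suc x C K) * ((n ∸ suc (suc x)) C T) * ((suc x ∸ K) * rest)
      ≡⟨ cong (λ z → (suc x C K) * (z C T) * ((suc x ∸ K) * rest)) (trans (∸-+-assoc n (suc x) 1) (cong (n ∸_) (+-comm (suc x) 1))) ⟨
    (suc x C K) * ((rest ∸ 1) C T) * ((suc x ∸ K) * rest)
      ≡⟨ swap-middle (suc x C K) ((rest ∸ 1) C T) (suc x ∸ K) rest ⟩
    ((suc x C K) * (suc x ∸ K)) * (((rest ∸ 1) C T) * rest)
      ≡⟨ cong₂ _*_ ([1+r]CK*[1+r∸K]≡rCK*[1+r] x K) ([m∸1]CT*m≡mCT*[m∸T] rest T) ⟩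
    ((x C K) * suc x) * ((rest C T) * (rest ∸ T))
      ≡⟨ swap-middle (x C K) (suc x) (rest C T) (rest ∸ T) ⟩
    (x C K) * (rest C T) * (suc x * (rest ∸ T)) ∎
    where
    open ≡-Reasoning
    rest = n ∸ suc x
    swap-middle : ∀ a b c d → a * b * (c * d) ≡ a * c * (b * d)
    swap-middle = solve-∀

  profile-step : ∀ c b → n ≡ suc (K + c) + (T + b) →
    g (suc (K + c)) * (suc c * (T + b)) ≡ g (K + c) * (suc (K + c) * b)
  profile-step c b n≡ = begin
    g (suc x) * (suc c * (T + b))                  ≡⟨ cong (λ z → g (suc x) * z) (cong₂ _*_ 1+x∸K≡1+c n∸[1+x]≡T+b) ⟨
    g (suc x) * ((suc x ∸ K) * (n ∸ suc x))        ≡⟨ profile-ratio x ⟩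
    g x * (suc x * (n ∸ suc x ∸ T))                ≡⟨ cong (λ z → g x * (suc x * (z ∸ T))) n∸[1+x]≡T+b ⟩
    g x * (suc x * (T + b ∸ T))                    ≡⟨ cong (λ z → g x * (suc x * z)) (m+n∸m≡n T b) ⟩
    g x * (suc x * b)                              ∎
    where
    open ≡-Reasoning
    x = K + c
    1+x∸K≡1+c : suc x ∸ K ≡ suc c
    1+x∸K≡1+c = trans (cong (_∸ K) (sym (+-suc K c))) (m+n∸m≡n K (suc c))
    n∸[1+x]≡T+b : n ∸ suc x ≡ T + b
    n∸[1+x]≡T+b = trans (cong (_∸ suc x) n≡) (m+n∸m≡n (suc x) (T + b))

  -- Comparing the maximum g (K + a) with its two neighbours.
  maximal⇒balanced : ∀ a B → n ≡ suc (K + a) + (T + B) → (∀ x → g x ≤ g (K + a)) → 0 < g (K + a) →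
    K * B ≤ suc a * T × a * T ≤ K * suc B
  maximal⇒balanced a B n≡ max g>0 = right-neighbour , left-neighbour a refl
    where
    open ≤-Reasoning
    right-neighbour : K * B ≤ suc a * T
    right-neighbour = +-cancelʳ-≤ (suc a * B) (K * B) (suc a * T) (begin
      K * B + suc a * B          ≡⟨ e K a B ⟩
      suc (K + a) * B            ≤⟨ *-cancelˡ-≤ (g (K + a)) {{>-nonZero g>0}} (begin
          g (K + a) * (suc (K + a) * B)      ≡⟨ profile-step a B n≡ ⟨
          g (suc (K + a)) * (suc a * (T + B)) ≤⟨ *-monoˡ-≤ _ (max (suc (K + a))) ⟩
          g (K + a) * (suc a * (T + B))       ∎) ⟩
      suc a * (T + B)            ≡⟨ *-distribˡ-+ (suc a) T B ⟩
      suc a * T + suc a * B      ∎)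
      where e : ∀ K a B → K * B + suc a * B ≡ suc (K + a) * B
            e = solve-∀
    left-neighbour : ∀ a′ → a′ ≡ a → a′ * T ≤ K * suc B
    left-neighbour zero      _    = z≤n
    left-neighbour (suc a′) refl = +-cancelʳ-≤ (suc a′ * suc B) (suc a′ * T) (K * suc B) (begin
      suc a′ * T + suc a′ * suc B    ≡⟨ *-distribˡ-+ (suc a′) T (suc B) ⟨
      suc a′ * (T + suc B)           ≤⟨ *-cancelˡ-≤ (g M) {{>-nonZero gM>0}} (begin
          g M * (suc a′ * (T + suc B))          ≡⟨ profile-step a′ (suc B) n≡′ ⟩
          g (K + a′) * (M * suc B)              ≤⟨ *-monoˡ-≤ _ (subst (g (K + a′) ≤_) gM≡ (max (K + a′))) ⟩
          g M * (M * suc B)                     ∎) ⟩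
      M * suc B                      ≡⟨ e K a′ (suc B) ⟩
      K * suc B + suc a′ * suc B     ∎)
      where
      M = suc (K + a′)
      gM≡ : g (K + suc a′) ≡ g M
      gM≡ = cong g (+-suc K a′)
      gM>0 : 0 < g M
      gM>0 = subst (0 <_) gM≡ g>0
      n≡′ : n ≡ suc (K + a′) + (T + suc B)
      n≡′ = trans n≡ (e′ K a′ T B)
        where e′ : ∀ K a′ T B → suc (K + suc a′) + (T + B) ≡ suc (K + a′) + (T + suc B)
              e′ = solve-∀
      e : ∀ K a′ s → suc (K + a′) * s ≡ K * s + suc a′ * s
      e = solve-∀

-- A maximum of the profile at K + a with B free places to its right, under t = (p/q) n and
-- K + 1 = (p′/q′) t; the window width w is about √n / (√8 q q′).
module Proportions {p q p′ q′ : ℕ} (p>0 : 0 < p) (p<q : p < q) (p′>0 : 0 < p′) (p′<q′ : p′ < q′)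
                   {n t K T a B : ℕ} (t*q≡p*n : t * q ≡ p * n) ([1+K]*q′≡p′*t : suc K * q′ ≡ p′ * t)
                   (t≡1+K+T : t ≡ suc K + T) (n≡t+a+B : n ≡ t + a + B) where

  open ≤-Reasoning

  q>0 : 0 < q
  q>0 = <-trans p>0 p<q

  q′>0 : 0 < q′
  q′>0 = <-trans p′>0 p′<q′

  n≤[1+a+B]*q : n ≤ suc (a + B) * q
  n≤[1+a+B]*q = ≤-trans n≤[a+B]*q (*-monoˡ-≤ q (n≤1+n (a + B)))
    where
    e : ∀ t a B q → (t + a + B) * q ≡ t * q + (a + B) * q
    e = solve-∀
    n≤[a+B]*q : n ≤ (a + B) * q
    n≤[a+B]*q = +-cancelˡ-≤ (t * q) n ((a + B) * q) (begin
      t * q + n             ≡⟨ cong (_+ n) t*q≡p*n ⟩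
      p * n + n             ≡⟨ +-comm (p * n) n ⟩
      suc p * n             ≤⟨ *-monoˡ-≤ n p<q ⟩
      q * n                 ≡⟨ *-comm q n ⟩
      n * q                 ≡⟨ cong (_* q) n≡t+a+B ⟩
      (t + a + B) * q       ≡⟨ e t a B q ⟩
      t * q + (a + B) * q   ∎)

  t≤T*q′ : t ≤ T * q′
  t≤T*q′ = +-cancelˡ-≤ (p′ * t) t (T * q′) (begin
    p′ * t + t            ≡⟨ +-comm (p′ * t) t ⟩
    suc p′ * t            ≤⟨ *-monoˡ-≤ t p′<q′ ⟩
    q′ * t                ≡⟨ *-comm q′ t ⟩
    t * q′                ≡⟨ cong (_* q′) t≡1+K+T ⟩
    (suc K + T) * q′      ≡⟨ *-distribʳ-+ q′ (suc K) T ⟩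
    suc K * q′ + T * q′   ≡⟨ cong (_+ T * q′) [1+K]*q′≡p′*t ⟩
    p′ * t + T * q′       ∎)

  K+T≤t : K + T ≤ t
  K+T≤t = subst (K + T ≤_) (sym t≡1+K+T) (n≤1+n (K + T))

  t>0 : 0 < t
  t>0 = subst (0 <_) (sym t≡1+K+T) (s≤s z≤n)

  1+a+B≤q′*[1+B] : a * T ≤ K * suc B → suc (a + B) ≤ q′ * suc B
  1+a+B≤q′*[1+B] aT≤K[1+B] = *-cancelˡ-≤ t {{>-nonZero t>0}} (begin
    t * suc (a + B)           ≤⟨ *-monoˡ-≤ (suc (a + B)) t≤T*q′ ⟩
    T * q′ * suc (a + B)      ≡⟨ e₁ T q′ (suc (a + B)) ⟩
    q′ * (T * suc (a + B))    ≤⟨ *-monoʳ-≤ q′ T[1+a+B]≤t[1+B] ⟩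
    q′ * (t * suc B)          ≡⟨ e₂ q′ t (suc B) ⟩
    t * (q′ * suc B)          ∎)
    where
    e₁ : ∀ T q′ R → T * q′ * R ≡ q′ * (T * R)
    e₁ = solve-∀
    e₂ : ∀ q′ t s → q′ * (t * s) ≡ t * (q′ * s)
    e₂ = solve-∀
    e₃ : ∀ T a B → T * suc (a + B) ≡ a * T + T * suc B
    e₃ = solve-∀
    T[1+a+B]≤t[1+B] : T * suc (a + B) ≤ t * suc B
    T[1+a+B]≤t[1+B] = begin
      T * suc (a + B)           ≡⟨ e₃ T a B ⟩
      a * T + T * suc B         ≤⟨ +-monoˡ-≤ (T * suc B) aT≤K[1+B] ⟩
      K * suc B + T * suc B     ≡⟨ *-distribʳ-+ (suc B) K T ⟨
      (K + T) * suc B           ≤⟨ *-monoˡ-≤ (suc B) K+T≤t ⟩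
      t * suc B                 ∎

  module _ {w : ℕ} (w>0 : 0 < w) (w²W≤n : w * w * (8 * q * q * q′ * q′) ≤ n) where

    2wqq′≤n : 2 * w * (q * q′) ≤ n
    2wqq′≤n = begin
      2 * w * (q * q′)                          ≤⟨ m≤m*n′ _ (*-positive (*-positive {4} (s≤s z≤n) w>0) (*-positive q>0 q′>0)) ⟩
      2 * w * (q * q′) * (4 * w * (q * q′))     ≡⟨ e w q q′ ⟨
      w * w * (8 * q * q * q′ * q′)             ≤⟨ w²W≤n ⟩
      n                                         ∎
      where e : ∀ w q q′ → w * w * (8 * q * q * q′ * q′) ≡ (2 * w * (q * q′)) * (4 * w * (q * q′))
            e = solve-∀

    2q′≤t : 2 * q′ ≤ t
    2q′≤t = *-cancelʳ-≤ (2 * q′) t q {{>-nonZero q>0}} (begin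
      2 * q′ * q          ≤⟨ m≤m*n′ (2 * q′ * q) w>0 ⟩
      2 * q′ * q * w      ≡⟨ e q q′ w ⟩
      2 * w * (q * q′)    ≤⟨ 2wqq′≤n ⟩
      n                   ≤⟨ m≤m*n′ n p>0 ⟩
      n * p               ≡⟨ trans (*-comm n p) (sym t*q≡p*n) ⟩
      t * q               ∎)
      where e : ∀ q q′ w → 2 * q′ * q * w ≡ 2 * w * (q * q′)
            e = solve-∀

    t≤2Kq′ : t ≤ 2 * (K * q′)
    t≤2Kq′ = +-cancelʳ-≤ (2 * q′) t (2 * (K * q′)) (begin
      t + 2 * q′                 ≤⟨ +-monoʳ-≤ t 2q′≤t ⟩
      t + t                      ≡⟨ cong (t +_) (+-identityʳ t) ⟨
      2 * t                      ≤⟨ *-monoˡ-≤ t (*-monoʳ-≤ 2 p′>0) ⟩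
      2 * p′ * t                 ≡⟨ *-assoc 2 p′ t ⟩
      2 * (p′ * t)               ≡⟨ cong (2 *_) [1+K]*q′≡p′*t ⟨
      2 * (suc K * q′)           ≡⟨ e K q′ ⟩
      2 * (K * q′) + 2 * q′      ∎)
      where e : ∀ K q′ → 2 * (suc K * q′) ≡ 2 * (K * q′) + 2 * q′
            e = solve-∀

    1+a+B≤2q′*[1+a] : K * B ≤ suc a * T → suc (a + B) ≤ 2 * q′ * suc a
    1+a+B≤2q′*[1+a] KB≤[1+a]T = *-cancelˡ-≤ t {{>-nonZero t>0}} (begin
      t * R                       ≤⟨ *-monoˡ-≤ R t≤2Kq′ ⟩
      2 * (K * q′) * R            ≡⟨ e₁ K q′ R ⟩
      2 * q′ * (K * R)            ≤⟨ *-monoʳ-≤ (2 * q′) KR≤[1+a]t ⟩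
      2 * q′ * (suc a * t)        ≡⟨ e₂ q′ (suc a) t ⟩
      t * (2 * q′ * suc a)        ∎)
      where
      R = suc (a + B)
      e₁ : ∀ K q′ R → 2 * (K * q′) * R ≡ 2 * q′ * (K * R)
      e₁ = solve-∀
      e₂ : ∀ q′ A t → 2 * q′ * (A * t) ≡ t * (2 * q′ * A)
      e₂ = solve-∀
      e₃ : ∀ K a B → K * suc (a + B) ≡ K * suc a + K * B
      e₃ = solve-∀
      KR≤[1+a]t : K * R ≤ suc a * t
      KR≤[1+a]t = begin
        K * R                     ≡⟨ e₃ K a B ⟩
        K * suc a + K * B         ≤⟨ +-monoʳ-≤ (K * suc a) KB≤[1+a]T ⟩
        K * suc a + suc a * T     ≡⟨ cong (_+ suc a * T) (*-comm K (suc a)) ⟩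
        suc a * K + suc a * T     ≡⟨ *-distribˡ-+ (suc a) K T ⟨
        suc a * (K + T)           ≤⟨ *-monoʳ-≤ (suc a) K+T≤t ⟩
        suc a * t                 ∎

    module _ (KB≤[1+a]T : K * B ≤ suc a * T) (aT≤K[1+B] : a * T ≤ K * suc B) where

      2w≤1+B : 2 * w ≤ suc B
      2w≤1+B = *-cancelʳ-≤ (2 * w) (suc B) (q * q′) {{>-nonZero (*-positive q>0 q′>0)}} (begin
        2 * w * (q * q′)        ≤⟨ 2wqq′≤n ⟩
        n                       ≤⟨ n≤[1+a+B]*q ⟩
        suc (a + B) * q         ≤⟨ *-monoˡ-≤ q (1+a+B≤q′*[1+B] aT≤K[1+B]) ⟩
        q′ * suc B * q          ≡⟨ e q′ (suc B) q ⟩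
        suc B * (q * q′)        ∎)
        where e : ∀ q′ s q → q′ * s * q ≡ s * (q * q′)
              e = solve-∀

      4w²t≤[1+a][1+B] : 4 * w * w * t ≤ suc a * suc B
      4w²t≤[1+a][1+B] = *-cancelˡ-≤ (2 * (q * q′) * (q * q′)) {{>-nonZero Q>0}} (begin
        2 * (q * q′) * (q * q′) * (4 * w * w * t)   ≡⟨ e₁ q q′ w t ⟩
        w * w * (8 * q * q * q′ * q′) * t           ≤⟨ *-monoˡ-≤ t w²W≤n ⟩
        n * t                                       ≤⟨ *-monoʳ-≤ n t≤n ⟩
        n * n                                       ≤⟨ *-mono-≤ n≤[1+a+B]*q n≤[1+a+B]*q ⟩
        R * q * (R * q)                             ≡⟨ e₂ R q ⟩
        R * R * (q * q)                             ≤⟨ *-monoˡ-≤ (q * q) (*-mono-≤ (1+a+B≤2q′*[1+a] KB≤[1+a]T) (1+a+B≤q′*[1+B] aT≤K[1+B])) ⟩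
        2 * q′ * suc a * (q′ * suc B) * (q * q)     ≡⟨ e₃ q q′ (suc a) (suc B) ⟩
        2 * (q * q′) * (q * q′) * (suc a * suc B)   ∎)
        where
        R = suc (a + B)
        Q>0 = *-positive (*-positive {2} (s≤s z≤n) (*-positive q>0 q′>0)) (*-positive q>0 q′>0)
        t≤n : t ≤ n
        t≤n = subst (t ≤_) (sym n≡t+a+B) (≤-trans (m≤m+n t a) (m≤m+n (t + a) B))
        e₁ : ∀ q q′ w t → 2 * (q * q′) * (q * q′) * (4 * w * w * t) ≡ w * w * (8 * q * q * q′ * q′) * t
        e₁ = solve-∀
        e₂ : ∀ R q → R * q * (R * q) ≡ R * R * (q * q)
        e₂ = solve-∀
        e₃ : ∀ q q′ A s → 2 * q′ * A * (q′ * s) * (q * q) ≡ 2 * (q * q′) * (q * q′) * (A * s)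
        e₃ = solve-∀

0<w⇒2w≤1+B⇒w≤B : ∀ {w B} → 0 < w → 2 * w ≤ suc B → w ≤ B
0<w⇒2w≤1+B⇒w≤B {w} {B} w>0 2w≤1+B = s≤s⁻¹ (begin
  suc w          ≡⟨ +-comm 1 w ⟩
  w + 1          ≤⟨ +-monoʳ-≤ w w>0 ⟩
  w + w          ≡⟨ cong (w +_) (+-identityʳ w) ⟨
  2 * w          ≤⟨ 2w≤1+B ⟩
  suc B          ∎)
  where open ≤-Reasoning

-- To the right of its maximum K + a the profile decays by a factor at most 1 - 1/(2w) per
-- step over a window of width w, because there is room 2w ≤ B + 1 to the right and the
-- product of the rooms on both sides dominates 4 w² t.
profile-slowDecay : ∀ n K T a B w → n ≡ suc (K + a) + (T + B) → a * T ≤ K * suc B →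
  0 < w → 2 * w ≤ suc B → 4 * w * w * suc (K + T) ≤ suc a * suc B →
  SlowlyDecaying (λ j → profile n K T (K + a + j)) w
profile-slowDecay n K T a B w n≡ aT≤K[1+B] w>0 2w≤1+B 4w²t≤[1+a][1+B] i i<w =
  subst (λ z → g x * (2 * w ∸ 1) ≤ g z * (2 * w)) (sym (+-suc (K + a) i))
    (ratio⇒slowDecay (g x) (g (suc x)) P Q w t ratio P≤Q+wt 2w²t≤P P>0 w>0)
  where
  open ≤-Reasoning
  g = profile n K T
  t = suc (K + T)
  x = K + a + i
  b = B ∸ i
  B≡b+i : B ≡ b + i
  B≡b+i = sym (m∸n+n≡m (≤-trans (<⇒≤ i<w) (0<w⇒2w≤1+B⇒w≤B w>0 2w≤1+B)))
  P = (suc a + i) * (T + b)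
  Q = suc x * b
  ratio : g (suc x) * P ≡ g x * Q
  ratio = subst (λ z → g (suc z) * P ≡ g z * (suc z * b)) (sym (+-assoc K a i))
    (profile-step n K T (a + i) b (trans n≡ (trans (cong (λ z → suc (K + a) + (T + z)) B≡b+i) (e K a T b i))))
    where e : ∀ K a T b i → suc (K + a) + (T + (b + i)) ≡ suc (K + (a + i)) + (T + b)
          e = solve-∀
  P≤Q+wt : P ≤ Q + w * t
  P≤Q+wt = begin
    P                                               ≡⟨ e₁ a i T b ⟩
    a * T + suc i * T + (suc a + i) * b             ≤⟨ +-monoˡ-≤ _ (+-monoˡ-≤ _ (≤-trans aT≤K[1+B] (≤-reflexive (cong (λ z → K * suc z) B≡b+i)))) ⟩
    K * suc (b + i) + suc i * T + (suc a + i) * b   ≡⟨ e₂ K b i T a ⟩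
    Q + suc i * (K + T)                             ≤⟨ +-monoʳ-≤ Q (*-mono-≤ i<w (n≤1+n (K + T))) ⟩
    Q + w * t                                       ∎
    where
    e₁ : ∀ a i T b → (suc a + i) * (T + b) ≡ a * T + suc i * T + (suc a + i) * b
    e₁ = solve-∀
    e₂ : ∀ K b i T a → K * suc (b + i) + suc i * T + (suc a + i) * b ≡ suc (K + a + i) * b + suc i * (K + T)
    e₂ = solve-∀
  1+B≤2b : suc B ≤ 2 * b
  1+B≤2b = +-cancelʳ-≤ (suc B) (suc B) (2 * b) (begin
    suc B + suc B                   ≡⟨ cong (λ z → suc z + suc z) B≡b+i ⟩
    suc (b + i) + suc (b + i)       ≡⟨ e b i ⟩
    2 * b + 2 * suc i               ≤⟨ +-monoʳ-≤ (2 * b) (*-monoʳ-≤ 2 i<w) ⟩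
    2 * b + 2 * w                   ≤⟨ +-monoʳ-≤ (2 * b) 2w≤1+B ⟩
    2 * b + suc B                   ∎)
    where e : ∀ b i → suc (b + i) + suc (b + i) ≡ 2 * b + 2 * suc i
          e = solve-∀
  2w²t≤P : 2 * w * w * t ≤ P
  2w²t≤P = ≤-trans (*-cancelˡ-≤ 2 (begin
      2 * (2 * w * w * t)     ≡⟨ e₁ w t ⟩
      4 * w * w * t           ≤⟨ 4w²t≤[1+a][1+B] ⟩
      suc a * suc B           ≤⟨ *-monoʳ-≤ (suc a) 1+B≤2b ⟩
      suc a * (2 * b)         ≡⟨ e₂ a b ⟩
      2 * (suc a * b)         ∎))
    (*-mono-≤ (m≤m+n (suc a) i) (m≤n+m b T))
    where
    e₁ : ∀ w t → 2 * (2 * w * w * t) ≡ 4 * w * w * t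
    e₁ = solve-∀
    e₂ : ∀ a b → suc a * (2 * b) ≡ 2 * (suc a * b)
    e₂ = solve-∀
  P>0 : 0 < P
  P>0 = <-≤-trans (*-positive (*-positive (*-positive {2} (s≤s z≤n) w>0) w>0) (s≤s z≤n)) 2w²t≤P

window-sum : ∀ (f : ℕ → ℕ) n M w → 0 < w → SlowlyDecaying (λ j → f (M + j)) w → M + suc w ≤ n →
  suc w * f M ≤ 2 * ∑< n f
window-sum f n M w w>0 decay M+1+w≤n = begin
  suc w * f M                        ≡⟨ cong (λ z → suc w * f z) (+-identityʳ M) ⟨
  suc w * h 0                        ≤⟨ ∑<-lowerBound (suc w) (h 0) (λ j → 2 * h j) (λ j j≤w → slowDecay⇒half h w w>0 decay j (s≤s⁻¹ j≤w)) ⟩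
  ∑< (suc w) (λ j → 2 * h j)         ≡⟨ ∑<-distribˡ-* (suc w) 2 h ⟩
  2 * ∑< (suc w) h                   ≤⟨ *-monoʳ-≤ 2 (∑<-window n M (suc w) f M+1+w≤n) ⟩
  2 * ∑< n f                         ∎
  where
  open ≤-Reasoning
  h = λ j → f (M + j)

module _ (n K T : ℕ) where

  private
    g = profile n K T

  profile-vanishes : 0 < T → ∀ x → n ≤ x → g x ≡ 0
  profile-vanishes T>0 x n≤x = begin
    (x C K) * ((n ∸ suc x) C T)   ≡⟨ cong (λ z → (x C K) * (z C T)) (m≤n⇒m∸n≡0 (m≤n⇒m≤1+n n≤x)) ⟩
    (x C K) * (0 C T)             ≡⟨ cong ((x C K) *_) (k>n⇒nCk≡0 T>0) ⟩
    (x C K) * 0                   ≡⟨ *-zeroʳ (x C K) ⟩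
    0                             ∎
    where open ≡-Reasoning

  profile-maximum : 0 < T → suc (K + T) ≤ n →
    ∃ λ a → ∃ λ B → n ≡ suc (K + a) + (T + B) × (∀ x → g x ≤ g (K + a)) × 0 < g (K + a)
  profile-maximum T>0 t≤n = a , B , n≡ , max′ , gM>0′
    where
    M = proj₁ (argmax g (n ∸ 1))
    M≤n∸1 = proj₁ (proj₂ (argmax g (n ∸ 1)))
    n>0 : 0 < n
    n>0 = ≤-trans (s≤s z≤n) t≤n
    M<n : M < n
    M<n = <-≤-trans (s≤s M≤n∸1) (≤-reflexive (m+[n∸m]≡n {1} {n} n>0))
    max : ∀ x → g x ≤ g M
    max x with x <? n
    ... | yes x<n = proj₂ (proj₂ (argmax g (n ∸ 1))) x (≤-trans (≤-reflexive (sym (m+n∸m≡n 1 x))) (∸-monoˡ-≤ 1 x<n))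
    ... | no x≮n  = ≤-trans (≤-reflexive (profile-vanishes T>0 x (≮⇒≥ x≮n))) z≤n
    gM>0 : 0 < g M
    gM>0 = <-≤-trans (*-positive (C-pos {K} {K} ≤-refl) (C-pos T≤n∸1∸K)) (max K)
      where T≤n∸1∸K = ≤-trans (≤-reflexive (sym (m+n∸m≡n (suc K) T))) (∸-monoˡ-≤ (suc K) t≤n)
    K≤M : K ≤ M
    K≤M with K ≤? M
    ... | yes K≤M = K≤M
    ... | no K≰M  = ⊥-elim (<-irrefl (sym (cong (_* ((n ∸ suc M) C T)) (k>n⇒nCk≡0 (≰⇒> K≰M)))) gM>0)
    T≤n∸1∸M : T ≤ n ∸ suc M
    T≤n∸1∸M with T ≤? n ∸ suc M
    ... | yes T≤ = T≤
    ... | no T≰  = ⊥-elim (<-irrefl (sym (trans (cong ((M C K) *_) (k>n⇒nCk≡0 (≰⇒> T≰))) (*-zeroʳ (M C K)))) gM>0)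
    a = M ∸ K
    B = n ∸ suc M ∸ T
    K+a≡M : K + a ≡ M
    K+a≡M = m+[n∸m]≡n K≤M
    n≡ : n ≡ suc (K + a) + (T + B)
    n≡ = sym (trans (cong (λ z → suc z + (T + B)) K+a≡M) (trans (cong (suc M +_) (m+[n∸m]≡n T≤n∸1∸M)) (m+[n∸m]≡n M<n)))
    max′ : ∀ x → g x ≤ g (K + a)
    max′ x = subst (λ z → g x ≤ g z) (sym K+a≡M) (max x)
    gM>0′ : 0 < g (K + a)
    gM>0′ = subst (λ z → 0 < g z) (sym K+a≡M) gM>0

proportion⇒T>0 : ∀ {K T t p′ q′} → p′ < q′ → suc K * q′ ≡ p′ * t → t ≡ suc K + T → 0 < T
proportion⇒T>0 {K} {zero}  {p′ = p′} {q′} p′<q′ [1+K]q′≡p′t refl =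
  ⊥-elim (<-irrefl (sym (*-cancelʳ-≡ q′ p′ (suc K) q′[1+K]≡p′[1+K])) p′<q′)
  where
  q′[1+K]≡p′[1+K] : q′ * suc K ≡ p′ * suc K
  q′[1+K]≡p′[1+K] = trans (*-comm q′ (suc K)) (trans [1+K]q′≡p′t (cong (p′ *_) (+-identityʳ (suc K))))
proportion⇒T>0 {T = suc T} _ _ _ = s≤s z≤n

module _ {p q p′ q′ : ℕ} (p>0 : 0 < p) (p<q : p < q) (p′>0 : 0 < p′) (p′<q′ : p′ < q′)
         {n t K T : ℕ} (t*q≡p*n : t * q ≡ p * n) ([1+K]*q′≡p′*t : suc K * q′ ≡ p′ * t)
         (t≡1+K+T : t ≡ suc K + T) (t≤n : t ≤ n) where

  private
    g = profile n K T
    W = 8 * q * q * q′ * q′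

  W>0 : 0 < W
  W>0 = *-positive (*-positive (*-positive (*-positive {8} (s≤s z≤n) q>0) q>0) q′>0) q′>0
    where
    q>0 = <-trans p>0 p<q
    q′>0 = <-trans p′>0 p′<q′

  profile-concentration : ∀ w → 0 < w → w * w * W ≤ n →
    ∃ λ M → (∀ x → g x ≤ g M) × suc w * g M ≤ 2 * ∑< n g
  profile-concentration w w>0 w²W≤n = K + a , max , window-sum g n (K + a) w w>0 decay window-fits
    where
    T>0 = proportion⇒T>0 p′<q′ [1+K]*q′≡p′*t t≡1+K+T
    maximum = profile-maximum n K T T>0 (subst (_≤ n) t≡1+K+T t≤n)
    a = proj₁ maximum
    B = proj₁ (proj₂ maximum)
    n≡ = proj₁ (proj₂ (proj₂ maximum))
    max = proj₁ (proj₂ (proj₂ (proj₂ maximum)))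
    balanced = maximal⇒balanced n K T a B n≡ max (proj₂ (proj₂ (proj₂ (proj₂ maximum))))
    n≡t+a+B : n ≡ t + a + B
    n≡t+a+B = trans n≡ (trans (e K a T B) (cong (λ z → z + a + B) (sym t≡1+K+T)))
      where e : ∀ K a T B → suc (K + a) + (T + B) ≡ suc K + T + a + B
            e = solve-∀
    open Proportions p>0 p<q p′>0 p′<q′ {n} {t} {K} {T} {a} {B} t*q≡p*n [1+K]*q′≡p′*t t≡1+K+T n≡t+a+B
    room = 2w≤1+B w>0 w²W≤n (proj₁ balanced) (proj₂ balanced)
    decay = profile-slowDecay n K T a B w n≡ (proj₂ balanced) w>0 room
      (subst (λ z → 4 * w * w * z ≤ suc a * suc B) t≡1+K+T (4w²t≤[1+a][1+B] w>0 w²W≤n (proj₁ balanced) (proj₂ balanced)))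
    window-fits : K + a + suc w ≤ n
    window-fits = begin
      K + a + suc w            ≤⟨ +-monoʳ-≤ (K + a) (s≤s (0<w⇒2w≤1+B⇒w≤B w>0 room)) ⟩
      K + a + suc B            ≡⟨ +-suc (K + a) B ⟩
      suc (K + a) + B          ≤⟨ +-monoʳ-≤ (suc (K + a)) (m≤n+m B T) ⟩
      suc (K + a) + (T + B)    ≡⟨ n≡ ⟨
      n                        ∎
      where open ≤-Reasoning

  profile²*n≤C²*total² : ∀ r → r < n → g r * g r * n ≤ (4 * W) * (4 * W) * (∑< n g * ∑< n g)
  profile²*n≤C²*total² r r<n with ∃-isqrt n W W>0
  ... | zero , _ , n<W = begin
    g r * g r * n          ≤⟨ *-mono-≤ (*-mono-≤ gr≤G gr≤G) (≤-trans (<⇒≤ n<W) (≤-reflexive (+-identityʳ W))) ⟩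
    G * G * W              ≤⟨ *-monoʳ-≤ (G * G) (≤-trans (m≤n*m W 4) (m≤m*n′ (4 * W) (*-positive {4} (s≤s z≤n) W>0))) ⟩
    G * G * (4 * W * (4 * W))  ≡⟨ *-comm (G * G) _ ⟩
    4 * W * (4 * W) * (G * G)  ∎
    where
    open ≤-Reasoning
    G = ∑< n g
    gr≤G = ∑<-term n r g r<n
  ... | w@(suc _) , w²W≤n , n<[w+1]²W = begin
    g r * g r * n                            ≤⟨ *-mono-≤ (*-mono-≤ (max r) (max r)) (<⇒≤ n<[w+1]²W) ⟩
    g M * g M * (suc w * suc w * W)          ≡⟨ e₁ (g M) (suc w) W ⟩
    (suc w * g M) * (suc w * g M) * W        ≤⟨ *-monoˡ-≤ W (*-mono-≤ concentrated concentrated) ⟩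
    (2 * G) * (2 * G) * W                    ≡⟨ e₂ G W ⟩
    4 * W * (G * G)                          ≤⟨ *-monoˡ-≤ (G * G) (m≤m*n′ (4 * W) (*-positive {4} (s≤s z≤n) W>0)) ⟩
    4 * W * (4 * W) * (G * G)                ∎
    where
    open ≤-Reasoning
    G = ∑< n g
    concentration = profile-concentration w (s≤s z≤n) w²W≤n
    M = proj₁ concentration
    max = proj₁ (proj₂ concentration)
    concentrated = proj₂ (proj₂ concentration)
    e₁ : ∀ a w W → a * a * (w * w * W) ≡ (w * a) * (w * a) * W
    e₁ = solve-∀
    e₂ : ∀ G W → (2 * G) * (2 * G) * W ≡ 4 * W * (G * G)
    e₂ = solve-∀

-- Counting O_σ and O_σ ∩ {rk(a_t) = r + 1}

module _ {n t} (t≤n : t ≤ n) (σ : Permutation′ t) where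

  private
    e : Fin t → Fin n
    e i = inject≤ (σ ⟨$⟩ʳ i) t≤n

  e-injective : IsInjection e
  e-injective i j eq = trans (sym (inverseˡ σ)) (trans (cong (σ ⟨$⟩ˡ_) (Finₚ.inject≤-injective t≤n t≤n _ _ eq)) (inverseˡ σ))

  open Restriction e e-injective public using (completionsPerKey)
  open Restriction e e-injective using (#joint; #total)

  countJoint≡ : ∀ k r → countJoint t≤n σ (e k) r ≡ profile n (toℕ k) (t ∸ suc (toℕ k)) (toℕ r) * completionsPerKey
  countJoint≡ k r = begin
    countJoint t≤n σ (e k) r
      ≡⟨ length-filter-filter isArrivalOrder? (λ π → Oσ? t≤n σ π ×-dec π (e k) ≟ r) (allFuns n n) ⟩
    ∑ (allFuns n n) (λ π → 𝟙 (isArrivalOrder? π) * 𝟙 (Oσ? t≤n σ π ×-dec π (e k) ≟ r))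
      ≡⟨⟩
    ∑ (allFuns n n) (λ π → 𝟙 (isInjection? π) * 𝟙 (isIncreasing? (π ∘ e) ×-dec π (e k) ≟ r))
      ≡⟨ #joint k r ⟩
    profile n (toℕ k) (t ∸ suc (toℕ k)) (toℕ r) * completionsPerKey ∎
    where open ≡-Reasoning

  countO≡ : ∀ k → countO t≤n σ ≡ ∑< n (profile n (toℕ k) (t ∸ suc (toℕ k))) * completionsPerKey
  countO≡ k = begin
    countO t≤n σ
      ≡⟨ length-filter-filter isArrivalOrder? (Oσ? t≤n σ) (allFuns n n) ⟩
    ∑ (allFuns n n) (λ π → 𝟙 (isArrivalOrder? π) * 𝟙 (Oσ? t≤n σ π))
      ≡⟨⟩
    ∑ (allFuns n n) (λ π → 𝟙 (isInjection? π) * 𝟙 (isIncreasing? (π ∘ e)))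
      ≡⟨ #total k ⟩
    ∑< n (profile n (toℕ k) (t ∸ suc (toℕ k))) * completionsPerKey ∎
    where open ≡-Reasoning

lemma3p10 : (p q p′ q′ : ℕ) → 0 < p → p < q → 0 < p′ → p′ < q′ →
    ∃ λ (C : ℕ) →
      ∀ (n t : ℕ) (t≤n : t ≤ n) (σ : Permutation′ t) (kidx : Fin t) (r : Fin n) →
        t * q ≡ p * n →
        suc (toℕ kidx) * q′ ≡ p′ * t →
        toℕ (σ ⟨$⟩ʳ kidx) ≡ t ∸ 1 →
        countJoint t≤n σ (inject≤ (σ ⟨$⟩ʳ kidx) t≤n) r
          * countJoint t≤n σ (inject≤ (σ ⟨$⟩ʳ kidx) t≤n) r * n
          ≤ C * C * (countO t≤n σ * countO t≤n σ)
lemma3p10 p q p′ q′ p>0 p<q p′>0 p′<q′ = c , λ n t t≤n σ k r t*q≡p*n [1+k]*q′≡p′*t _ →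
  let K = toℕ k
      g = profile n K (t ∸ suc K)
      N = completionsPerKey t≤n σ
      G = ∑< n g
  in begin
    countJoint t≤n σ _ r * countJoint t≤n σ _ r * n   ≡⟨ cong (λ z → z * z * n) (countJoint≡ t≤n σ k r) ⟩
    (g (toℕ r) * N) * (g (toℕ r) * N) * n             ≡⟨ e₁ (g (toℕ r)) N n ⟩
    g (toℕ r) * g (toℕ r) * n * (N * N)               ≤⟨ *-monoˡ-≤ (N * N) (profile²*n≤C²*total² p>0 p<q p′>0 p′<q′ {n} {t} {K} {t ∸ suc K} t*q≡p*n [1+k]*q′≡p′*t
                                                            (sym (m+[n∸m]≡n (Finₚ.toℕ<n k))) t≤n (toℕ r) (Finₚ.toℕ<n r)) ⟩
    c * c * (G * G) * (N * N)                          ≡⟨ e₂ c G N ⟩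
    c * c * ((G * N) * (G * N))                        ≡⟨ cong (λ z → c * c * (z * z)) (countO≡ t≤n σ k) ⟨
    c * c * (countO t≤n σ * countO t≤n σ)              ∎
  where
  open ≤-Reasoning
  c = 4 * (8 * q * q * q′ * q′)
  e₁ : ∀ a b n → (a * b) * (a * b) * n ≡ a * a * n * (b * b)
  e₁ = solve-∀
  e₂ : ∀ c G N → c * c * (G * G) * (N * N) ≡ c * c * ((G * N) * (G * N))
  e₂ = solve-∀
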